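{- Let $a,b$ be nonnegative integers. For each $1\le i\le 2a+b+1$ there exists a polynomial $P_{a,b,i}(d,m,q)$ in $d,m,q$ with $\deg_m P_{a,b,i}\le 2a+b+1-i$ such that, for all integers $d\ge1$, $m\ge0$, $$\sum_{n\ge0}G^+_{d,m,a,b}(n)\,q^n=\sum_{i=1}^{2a+b+1}\frac{P_{a,b,i}(d,m,q)}{(1-q-dq^2)^i}.$$
   Context: For integers $d\ge1$, $n\ge0$ let $\mathcal{A}_{d,n}=\{(i,j):1\le i\le d,\ 1\le j\le n\}$. A subset $I\subseteq\mathcal{A}_{d,n}$ is nice if (1) $(i+1,j)\in I$ with $i\ge1$ implies $(i,j)\in I$, and (2) $(1,j)\in I$ with $1\le j\le n-1$ implies $(1,j+1)\notin I$. $\mathcal{B}^+_{d,n}$ is the set of nice subsets of $\mathcal{A}_{d,n}$ (for $n=0$ it is $\{\emptyset\}$). For $I$ nice, $|I|$ is its cardinality and $\sigma_m(I)=\sum_{(i,j)\in I}((i-1)m+j)$. Define $G^+_{d,m,a,b}(n)=\sum_{I\in\mathcal{B}^+_{d,n}}\sigma_m(I)^a|I|^b$ (with $0^0=1$). -}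

module Defs where

open import Data.Bool using (Bool; true; false; if_then_else_; _∧_; not; _∨_)
open import Data.Nat as ℕ using (ℕ; zero; suc; _≡ᵇ_; _∸_)
open import Data.Fin using (Fin; toℕ)
open import Data.Vec using (Vec; []; _∷_; lookup)
open import Data.List as List using (List; []; _∷_; concatMap; foldr; upTo; allFin)
open import Data.Product using (_×_; _,_)
open import Data.Nat.ListAction renaming (sum to sumℕ)
open import Data.Integer using (+_)
open import Data.Rational as ℚ using (ℚ; 0ℚ; 1ℚ; _/_)

-- A subset I ⊆ A_{d,n} is encoded as a grid  Vec (Vec Bool d) n :
-- entry  lookup (lookup I j) i  (0-based Fin indices) is true iff
-- the pair (toℕ i + 1 , toℕ j + 1) belongs to I.

Grid : ℕ → ℕ → Set
Grid d n = Vec (Vec Bool d) n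

allVecs : {A : Set} → (k : ℕ) → List A → List (Vec A k)
allVecs zero    xs = [] ∷ []
allVecs (suc k) xs = concatMap (λ x → List.map (x ∷_) (allVecs k xs)) xs

allGrids : (d n : ℕ) → List (Grid d n)
allGrids d n = allVecs n (allVecs d (true ∷ false ∷ []))

_⇒ᵇ_ : Bool → Bool → Bool
x ⇒ᵇ y = not x ∨ y

-- condition (1) on one column: (i+1,j) ∈ I implies (i,j) ∈ I
colOK : {k : ℕ} → Vec Bool k → Bool
colOK []           = true
colOK (x ∷ [])     = true
colOK (x ∷ y ∷ r)  = (y ⇒ᵇ x) ∧ colOK (y ∷ r)

-- whether (1,j) ∈ I for column j (false if d = 0, where there is no row 1)
row1 : {k : ℕ} → Vec Bool k → Bool
row1 []      = false
row1 (x ∷ _) = x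

-- condition (2): (1,j) ∈ I implies (1,j+1) ∉ I
adjOK : {d n : ℕ} → Grid d n → Bool
adjOK []               = true
adjOK (c ∷ [])         = true
adjOK (c ∷ c' ∷ r)     = (row1 c ⇒ᵇ not (row1 c')) ∧ adjOK (c' ∷ r)

allCols : {d n : ℕ} → Grid d n → Bool
allCols []      = true
allCols (c ∷ r) = colOK c ∧ allCols r

isNice : {d n : ℕ} → Grid d n → Bool
isNice I = allCols I ∧ adjOK I

card : {d n : ℕ} → Grid d n → ℕ
card {d} {n} I =
  sumℕ (List.map (λ j → sumℕ (List.map (λ i →
    if lookup (lookup I j) i then 1 else 0) (allFin d))) (allFin n))

-- σ_m(I) = Σ_{(i,j) ∈ I} ((i-1) m + j)   (1-based i, j)
sigma : {d n : ℕ} → ℕ → Grid d n → ℕ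
sigma {d} {n} m I =
  sumℕ (List.map (λ j → sumℕ (List.map (λ i →
    if lookup (lookup I j) i then toℕ i ℕ.* m ℕ.+ suc (toℕ j) else 0)
      (allFin d))) (allFin n))

-- G^+_{d,m,a,b}(n) = Σ_{I ∈ B^+_{d,n}} σ_m(I)^a |I|^b   (note 0 ^ 0 = 1)
Gplus : (d m a b n : ℕ) → ℕ
Gplus d m a b n =
  sumℕ (List.map (λ I → if isNice I then (sigma m I ℕ.^ a) ℕ.* (card I ℕ.^ b) else 0)
                     (allGrids d n))

-- Polynomials in d, m, q with rational coefficients:
-- a finite list of monomials  (c , e_d , e_m , e_q)  meaning  c d^e_d m^e_m q^e_q.

Poly3 : Set
Poly3 = List (ℚ × ℕ × ℕ × ℕ)

degm≤ : Poly3 → ℕ → Set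
degm≤ []                     k = Data.Unit.⊤
  where import Data.Unit
degm≤ ((c , ed , em , eq) ∷ P) k = (em ℕ.≤ k) × degm≤ P k

Series : Set
Series = ℕ → ℚ

fromℕ : ℕ → ℚ
fromℕ n = + n / 1

polySeries : Poly3 → ℕ → ℕ → Series
polySeries []                       d m k = 0ℚ
polySeries ((c , ed , em , eq) ∷ P) d m k =
  (if eq ≡ᵇ k then c ℚ.* fromℕ ((d ℕ.^ ed) ℕ.* (m ℕ.^ em)) else 0ℚ)
  ℚ.+ polySeries P d m k

sumℚ : List ℚ → ℚ
sumℚ = foldr ℚ._+_ 0ℚ

_⊛_ : Series → Series → Series
(f ⊛ g) n = sumℚ (List.map (λ k → f k ℚ.* g (n ∸ k)) (upTo (suc n)))

oneS : Series
oneS zero    = 1ℚ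
oneS (suc _) = 0ℚ

_^S_ : Series → ℕ → Series
f ^S zero  = oneS
f ^S suc i = f ⊛ (f ^S i)

-- 1 / (1 - q - d q^2) as a power series: the unique series f with
-- (1 - q - d q^2) f = 1, i.e. f_0 = 1, f_1 = 1, f_{n+2} = f_{n+1} + d f_n.
invD : ℕ → Series
invD d zero          = 1ℚ
invD d (suc zero)    = 1ℚ
invD d (suc (suc n)) = invD d (suc n) ℚ.+ fromℕ d ℚ.* invD d n

sumS : {N : ℕ} → (Fin N → Series) → Series
sumS {N} F n = sumℚ (List.map (λ k → F k n) (allFin N))

module Submission where

-- Write M_{α,β}(n) = Σ_{I nice} σ_m(I)^α |I|^β (so G⁺ = M_{a,b})
-- and call W = 2α + β its weight.  Reading a nice subset column by column,
-- every column is a tower {1,…,h}, and no two adjacent columns are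
-- non-empty; splitting off the first column gives
--     M(n+2) = M(n+1) + d·M(n) + t(n+2),
-- where t collects, after expanding the shifted weights binomially and
-- summing polynomials in the tower height h over h = 1,…,d, combinations of
-- moments of weight < W with coefficients polynomial in d and m, of m-degree
-- bounded by the weight they lose.  So M = t/(1 - q - d q²), and by strong
-- induction on W every moment is 1/(1 - q - d q²) times a "Horner list" of
-- rank W, which is exactly the partial-fraction shape of the theorem.

open import Defs
open import Algebra.Bundles using (CommutativeRing)
open import Data.Bool using (Bool; true; false; if_then_else_; _∧_; not)
open import Data.Empty using (⊥; ⊥-elim)
open import Data.Fin as Fin using (Fin; toℕ)
import Data.Integer as ℤ
import Data.Integer.Properties as ℤP
open import Data.List as List using (List; []; _∷_; _++_; concatMap; length; allFin; tabulate; applyUpTo)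
import Data.List.Properties as ListP
open import Data.Nat as ℕ using (ℕ; zero; suc; z≤n; s≤s; _≡ᵇ_)
import Data.Nat.Properties as ℕP
import Data.Nat.Coprimality as Coprime
open import Data.Nat.ListAction using () renaming (sum to sumℕ)
open import Data.Nat.Tactic.RingSolver using (solve-∀)
open import Data.Product using (Σ; _×_; _,_; proj₁; proj₂)
open import Data.Rational as Rational using (ℚ; 0ℚ; 1ℚ; ½)
import Data.Rational.Properties as ℚP
import Data.Rational.Unnormalised as ℚᵘ
import Data.Rational.Unnormalised.Properties as ℚᵘP
open import Algebra.Properties.CommutativeSemiring.Exp
  (CommutativeRing.commutativeSemiring ℚP.+-*-commutativeRing) using (_^_; ^-homo-*)
open import Data.Rational.Solver using (module +-*-Solver)
open +-*-Solver using (solve; _:+_; _:*_; :-_; _:=_; con)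
open import Data.Unit using (⊤; tt)
open import Data.Vec using (Vec; []; _∷_; lookup; replicate)
open import Relation.Binary.PropositionalEquality
open ≡-Reasoning

module NatCast where

  open Rational using (_+_; _*_; -_)

  fromℕ≡mkℚ : ∀ n → fromℕ n ≡ Rational.mkℚ (ℤ.+ n) 0 (Coprime.sym (Coprime.1-coprimeTo n))
  fromℕ≡mkℚ n = ℚP.normalize-coprime (Coprime.sym (Coprime.1-coprimeTo n))

  toℚᵘ-fromℕ : ∀ n → Rational.toℚᵘ (fromℕ n) ≡ ℚᵘ.mkℚᵘ (ℤ.+ n) 0
  toℚᵘ-fromℕ n rewrite fromℕ≡mkℚ n = refl

  -- fromℕ is a semiring homomorphism; both laws are transported from the
  -- unnormalised rationals, where they hold on numerators.
  fromℕ-+ : ∀ a b → fromℕ (a ℕ.+ b) ≡ fromℕ a + fromℕ b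
  fromℕ-+ a b = ℚP.toℚᵘ-injective (ℚᵘP.≃-trans (ℚᵘP.≃-reflexive (toℚᵘ-fromℕ (a ℕ.+ b)))
    (ℚᵘP.≃-trans numerators (ℚᵘP.≃-sym (ℚP.toℚᵘ-homo-+ (fromℕ a) (fromℕ b)))))
    where
    numerators : ℚᵘ.mkℚᵘ (ℤ.+ (a ℕ.+ b)) 0 ℚᵘ.≃ (Rational.toℚᵘ (fromℕ a) ℚᵘ.+ Rational.toℚᵘ (fromℕ b))
    numerators rewrite toℚᵘ-fromℕ a | toℚᵘ-fromℕ b =
      ℚᵘ.*≡* (cong (ℤ._* ℤ.+ 1) (trans (sym (ℤP.pos-+ a b))
        (sym (cong₂ ℤ._+_ (ℤP.*-identityʳ (ℤ.+ a)) (ℤP.*-identityʳ (ℤ.+ b))))))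

  fromℕ-* : ∀ a b → fromℕ (a ℕ.* b) ≡ fromℕ a * fromℕ b
  fromℕ-* a b = ℚP.toℚᵘ-injective (ℚᵘP.≃-trans (ℚᵘP.≃-reflexive (toℚᵘ-fromℕ (a ℕ.* b)))
    (ℚᵘP.≃-trans numerators (ℚᵘP.≃-sym (ℚP.toℚᵘ-homo-* (fromℕ a) (fromℕ b)))))
    where
    numerators : ℚᵘ.mkℚᵘ (ℤ.+ (a ℕ.* b)) 0 ℚᵘ.≃ (Rational.toℚᵘ (fromℕ a) ℚᵘ.* Rational.toℚᵘ (fromℕ b))
    numerators rewrite toℚᵘ-fromℕ a | toℚᵘ-fromℕ b = ℚᵘ.*≡* (cong (ℤ._* ℤ.+ 1) (ℤP.pos-* a b))

  fromℕ-^ : ∀ n a → fromℕ (n ℕ.^ a) ≡ fromℕ n ^ a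
  fromℕ-^ n zero    = refl
  fromℕ-^ n (suc a) = trans (fromℕ-* n (n ℕ.^ a)) (cong (fromℕ n *_) (fromℕ-^ n a))

  fromℕ-pred : ∀ d → fromℕ (suc d) + - 1ℚ ≡ fromℕ d
  fromℕ-pred d = trans (cong (_+ - 1ℚ) (fromℕ-+ 1 d))
    (solve 1 (λ D → con 1ℚ :+ D :+ :- con 1ℚ := D) refl (fromℕ d))

  -- Positive integers are invertible in ℚ (needed to divide by the
  -- binomial coefficient in the power-sum formula).
  fromℕ-suc-invertible : ∀ e → Σ ℚ (λ i → fromℕ (suc e) * i ≡ 1ℚ)
  fromℕ-suc-invertible e rewrite fromℕ≡mkℚ (suc e) = Rational.1/ q , ℚP.*-inverseʳ q
    where q = Rational.mkℚ (ℤ.+ suc e) 0 (Coprime.sym (Coprime.1-coprimeTo (suc e)))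

module PowerSeries where
  -- The Cauchy
  -- product  _⊛_  of Defs is a sum over a list; we work with the equivalent
  -- structurally recursive product  conv , for which the commutative-algebra
  -- laws are proved by induction on the coefficient index.

  open Rational using (_+_; _*_)

  infix 4 _≐_

  _≐_ : Series → Series → Set
  f ≐ g = ∀ k → f k ≡ g k

  tailS : Series → Series
  tailS f k = f (suc k)

  _⊕_ : Series → Series → Series
  (f ⊕ g) k = f k + g k

  _·_ : ℚ → Series → Series
  (c · f) k = c * f k

  zeroS : Series
  zeroS _ = 0ℚ

  shiftS : Series → Series
  shiftS f zero    = 0ℚ
  shiftS f (suc n) = f n

  -- (f g)_n = f_0 g_n + ((f - f_0)/q · g)_{n-1}.
  conv : Series → Series → Series
  conv f g zero    = f 0 * g 0
  conv f g (suc n) = f 0 * g (suc n) + conv (tailS f) g n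

  conv-cong : ∀ {f f' g g'} → f ≐ f' → g ≐ g' → conv f g ≐ conv f' g'
  conv-cong ef eg zero    = cong₂ _*_ (ef 0) (eg 0)
  conv-cong ef eg (suc n) =
    cong₂ _+_ (cong₂ _*_ (ef 0) (eg (suc n))) (conv-cong (λ k → ef (suc k)) eg n)

  conv-congʳ : ∀ f {g g'} → g ≐ g' → conv f g ≐ conv f g'
  conv-congʳ f = conv-cong (λ _ → refl)

  conv-+ˡ : ∀ f f' g → conv (f ⊕ f') g ≐ (conv f g ⊕ conv f' g)
  conv-+ˡ f f' g zero    = ℚP.*-distribʳ-+ (g 0) (f 0) (f' 0)
  conv-+ˡ f f' g (suc n) rewrite conv-+ˡ (tailS f) (tailS f') g n =
    solve 5 (λ a b c d e → (a :+ b) :* c :+ (d :+ e) := (a :* c :+ d) :+ (b :* c :+ e)) refl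
      (f 0) (f' 0) (g (suc n)) (conv (tailS f) g n) (conv (tailS f') g n)

  conv-+ʳ : ∀ f g g' → conv f (g ⊕ g') ≐ (conv f g ⊕ conv f g')
  conv-+ʳ f g g' zero    = ℚP.*-distribˡ-+ (f 0) (g 0) (g' 0)
  conv-+ʳ f g g' (suc n) rewrite conv-+ʳ (tailS f) g g' n =
    solve 5 (λ a b c d e → a :* (b :+ c) :+ (d :+ e) := (a :* b :+ d) :+ (a :* c :+ e)) refl
      (f 0) (g (suc n)) (g' (suc n)) (conv (tailS f) g n) (conv (tailS f) g' n)

  conv-·ˡ : ∀ c f g → conv (c · f) g ≐ (c · conv f g)
  conv-·ˡ c f g zero    = ℚP.*-assoc c (f 0) (g 0)
  conv-·ˡ c f g (suc n) rewrite conv-·ˡ c (tailS f) g n =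
    solve 4 (λ c a b d → c :* a :* b :+ c :* d := c :* (a :* b :+ d)) refl
      c (f 0) (g (suc n)) (conv (tailS f) g n)

  conv-·ʳ : ∀ c f g → conv f (c · g) ≐ (c · conv f g)
  conv-·ʳ c f g zero    = solve 3 (λ c a b → a :* (c :* b) := c :* (a :* b)) refl c (f 0) (g 0)
  conv-·ʳ c f g (suc n) rewrite conv-·ʳ c (tailS f) g n =
    solve 4 (λ c a b d → a :* (c :* b) :+ c :* d := c :* (a :* b :+ d)) refl
      c (f 0) (g (suc n)) (conv (tailS f) g n)

  conv-0ˡ : ∀ g → conv zeroS g ≐ zeroS
  conv-0ˡ g zero    = ℚP.*-zeroˡ (g 0)
  conv-0ˡ g (suc n) rewrite conv-0ˡ g n | ℚP.*-zeroˡ (g (suc n)) = refl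

  conv-sucʳ : ∀ f g n → conv f g (suc n) ≡ conv f (tailS g) n + f (suc n) * g 0
  conv-sucʳ f g zero    = refl
  conv-sucʳ f g (suc n) rewrite conv-sucʳ (tailS f) g n =
    sym (ℚP.+-assoc (f 0 * g (suc (suc n))) (conv (tailS f) (tailS g) n) (f (suc (suc n)) * g 0))

  -- Commutativity, by comparing the first and the last term.
  conv-comm : ∀ f g → conv f g ≐ conv g f
  conv-comm f g zero    = ℚP.*-comm (f 0) (g 0)
  conv-comm f g (suc n) rewrite conv-comm (tailS f) g n | conv-sucʳ g f n =
    trans (ℚP.+-comm (f 0 * g (suc n)) (conv g (tailS f) n))
          (cong (conv g (tailS f) n +_) (ℚP.*-comm (f 0) (g (suc n))))

  conv-0ʳ : ∀ f → conv f zeroS ≐ zeroS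
  conv-0ʳ f n = trans (conv-comm f zeroS n) (conv-0ˡ f n)

  conv-assoc : ∀ f g h → conv (conv f g) h ≐ conv f (conv g h)
  conv-assoc f g h zero    = ℚP.*-assoc (f 0) (g 0) (h 0)
  conv-assoc f g h (suc n) = begin
    (f 0 * g 0) * h (suc n) + conv (tailS (conv f g)) h n
      ≡⟨ cong ((f 0 * g 0) * h (suc n) +_)
           (trans (conv-+ˡ (f 0 · tailS g) (conv (tailS f) g) h n)
                  (cong₂ _+_ (conv-·ˡ (f 0) (tailS g) h n) (conv-assoc (tailS f) g h n))) ⟩
    (f 0 * g 0) * h (suc n) + (f 0 * conv (tailS g) h n + conv (tailS f) (conv g h) n)
      ≡⟨ solve 5 (λ a b c d e → (a :* b) :* c :+ (a :* d :+ e) := a :* (b :* c :+ d) :+ e) refl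
           (f 0) (g 0) (h (suc n)) (conv (tailS g) h n) (conv (tailS f) (conv g h) n) ⟩
    f 0 * conv g h (suc n) + conv (tailS f) (conv g h) n ∎

  conv-oneˡ : ∀ g → conv oneS g ≐ g
  conv-oneˡ g zero    = ℚP.*-identityˡ (g 0)
  conv-oneˡ g (suc n) rewrite conv-0ˡ g n | ℚP.*-identityˡ (g (suc n)) = ℚP.+-identityʳ _

  conv-oneʳ : ∀ g → conv g oneS ≐ g
  conv-oneʳ g n = trans (conv-comm g oneS n) (conv-oneˡ g n)

  conv-shiftˡ : ∀ f g → conv (shiftS f) g ≐ shiftS (conv f g)
  conv-shiftˡ f g zero    = ℚP.*-zeroˡ (g 0)
  conv-shiftˡ f g (suc n) rewrite ℚP.*-zeroˡ (g (suc n)) = ℚP.+-identityˡ _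

  conv-shiftʳ : ∀ f g → conv f (shiftS g) ≐ shiftS (conv f g)
  conv-shiftʳ f g zero    = ℚP.*-zeroʳ (f 0)
  conv-shiftʳ f g (suc n) =
    trans (conv-comm f (shiftS g) (suc n)) (trans (conv-shiftˡ g f (suc n)) (conv-comm g f n))

  ⊛≐conv : ∀ f g → (f ⊛ g) ≐ conv f g
  ⊛≐conv f g n = trans (cong sumℚ (ListP.map-upTo (λ k → f k * g (n ℕ.∸ k)) (suc n))) (unfold f n)
    where
    unfold : ∀ f n → sumℚ (applyUpTo (λ k → f k * g (n ℕ.∸ k)) (suc n)) ≡ conv f g n
    unfold f zero    = ℚP.+-identityʳ _
    unfold f (suc n) = cong (f 0 * g (suc n) +_) (unfold (tailS f) n)

  ⊛-cong : ∀ {f f' g g'} → f ≐ f' → g ≐ g' → (f ⊛ g) ≐ (f' ⊛ g')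
  ⊛-cong {f} {f'} {g} {g'} ef eg n =
    trans (⊛≐conv f g n) (trans (conv-cong ef eg n) (sym (⊛≐conv f' g' n)))

  ^S-suc : ∀ f i → (f ^S suc i) ≐ conv f (f ^S i)
  ^S-suc f i = ⊛≐conv f (f ^S i)

  sumS-suc : ∀ {L} (G : Fin (suc L) → Series) →
             sumS G ≐ (G Fin.zero ⊕ sumS (λ k → G (Fin.suc k)))
  sumS-suc {L} G n = cong (λ z → G Fin.zero n + sumℚ z)
    (trans (ListP.map-tabulate Fin.suc (λ k → G k n))
           (sym (ListP.map-tabulate (λ k → k) (λ k → G (Fin.suc k) n))))

  sumS-cong : ∀ {L} {G H : Fin L → Series} → (∀ k → G k ≐ H k) → sumS G ≐ sumS H
  sumS-cong {L} e n = cong sumℚ (ListP.map-cong (λ k → e k n) (allFin L))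

  conv-sumS : ∀ {L} f (G : Fin L → Series) → conv f (sumS G) ≐ sumS (λ k → conv f (G k))
  conv-sumS {zero}  f G n = conv-0ʳ f n
  conv-sumS {suc L} f G n = begin
    conv f (sumS G) n
      ≡⟨ conv-congʳ f (sumS-suc G) n ⟩
    conv f (G Fin.zero ⊕ sumS (λ k → G (Fin.suc k))) n
      ≡⟨ conv-+ʳ f (G Fin.zero) (sumS (λ k → G (Fin.suc k))) n ⟩
    conv f (G Fin.zero) n + conv f (sumS (λ k → G (Fin.suc k))) n
      ≡⟨ cong (conv f (G Fin.zero) n +_) (conv-sumS f (λ k → G (Fin.suc k)) n) ⟩
    conv f (G Fin.zero) n + sumS (λ k → conv f (G (Fin.suc k))) n
      ≡⟨ sym (sumS-suc (λ k → conv f (G k)) n) ⟩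
    sumS (λ k → conv f (G k)) n ∎

  invD-conv-recurrence : ∀ d t n →
    conv (invD d) t (suc (suc n)) ≡ t (suc (suc n)) + conv (invD d) t (suc n) + fromℕ d * conv (invD d) t n
  invD-conv-recurrence d t n = begin
    1ℚ * t (suc (suc n)) + (1ℚ * t (suc n) + conv (tailS (tailS (invD d))) t n)
      ≡⟨ cong (λ z → 1ℚ * t (suc (suc n)) + (1ℚ * t (suc n) + z))
           (trans (conv-+ˡ (tailS (invD d)) (fromℕ d · invD d) t n)
                  (cong (conv (tailS (invD d)) t n +_) (conv-·ˡ (fromℕ d) (invD d) t n))) ⟩
    1ℚ * t (suc (suc n)) + (1ℚ * t (suc n) + (conv (tailS (invD d)) t n + fromℕ d * conv (invD d) t n))
      ≡⟨ solve 5 (λ a b c d' e → con 1ℚ :* a :+ (con 1ℚ :* b :+ (c :+ d' :* e))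
                                 := a :+ (con 1ℚ :* b :+ c) :+ d' :* e) refl
           (t (suc (suc n))) (t (suc n)) (conv (tailS (invD d)) t n) (fromℕ d) (conv (invD d) t n) ⟩
    t (suc (suc n)) + conv (invD d) t (suc n) + fromℕ d * conv (invD d) t n ∎

  recurrence-unique : ∀ (c : ℚ) (f g t : Series) → f 0 ≡ g 0 → f 1 ≡ g 1 →
    (∀ n → f (suc (suc n)) ≡ t n + f (suc n) + c * f n) →
    (∀ n → g (suc (suc n)) ≡ t n + g (suc n) + c * g n) → f ≐ g
  recurrence-unique c f g t e0 e1 rf rg n = proj₁ (consecutive n)
    where
    consecutive : ∀ n → f n ≡ g n × f (suc n) ≡ g (suc n)
    consecutive zero    = e0 , e1
    consecutive (suc n) with consecutive n
    ... | p , q = q , trans (rf n) (trans (cong₂ (λ x y → t n + x + c * y) q p) (sym (rg n)))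

module PartialFractions where
  -- A Horner list  N₀ ∷ N₁ ∷ … ∷ N_r  of polynomials in d, m, q denotes the
  -- series  N₀ + (N₁ + (N₂ + …)/D)/D = Σ_j N_j / D^j.

  open Rational using (_+_; _*_)
  open NatCast
  open PowerSeries

  polySeries-++ : ∀ P Q d m → polySeries (P ++ Q) d m ≐ (polySeries P d m ⊕ polySeries Q d m)
  polySeries-++ [] Q d m k = sym (ℚP.+-identityˡ (polySeries Q d m k))
  polySeries-++ ((c , ed , em , eq) ∷ P) Q d m k rewrite polySeries-++ P Q d m k =
    sym (ℚP.+-assoc (if eq ≡ᵇ k then c * fromℕ ((d ℕ.^ ed) ℕ.* (m ℕ.^ em)) else 0ℚ)
                    (polySeries P d m k) (polySeries Q d m k))

  degm-++ : ∀ P Q k → degm≤ P k → degm≤ Q k → degm≤ (P ++ Q) k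
  degm-++ []                      Q k _       q = q
  degm-++ ((c , ed , em , eq) ∷ P) Q k (e , p) q = e , degm-++ P Q k p q

  degm-weaken : ∀ P {k k'} → k ℕ.≤ k' → degm≤ P k → degm≤ P k'
  degm-weaken []                      _  _       = tt
  degm-weaken ((c , ed , em , eq) ∷ P) le (e , p) = ℕP.≤-trans e le , degm-weaken P le p

  ParamMono : Set
  ParamMono = ℚ × ℕ × ℕ

  evalParam : ParamMono → ℕ → ℕ → ℚ
  evalParam (c , a , e) d m = c * fromℕ ((d ℕ.^ a) ℕ.* (m ℕ.^ e))

  scaleMono : ParamMono → Poly3 → Poly3
  scaleMono (c , a , e) = List.map (λ { (c' , a' , e' , j) → (c * c' , a ℕ.+ a' , e' ℕ.+ e , j) })

  polySeries-scale : ∀ x P d m → polySeries (scaleMono x P) d m ≐ (evalParam x d m · polySeries P d m)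
  polySeries-scale (c , a , e) [] d m k = sym (ℚP.*-zeroʳ (evalParam (c , a , e) d m))
  polySeries-scale (c , a , e) ((c' , a' , e' , j) ∷ P) d m k =
    trans (cong₂ (λ z w → (if j ≡ᵇ k then (c * c') * z else 0ℚ) + w)
                 monomial-product (polySeries-scale (c , a , e) P d m k))
          (distribute (j ≡ᵇ k) (polySeries P d m k))
    where
    X = fromℕ ((d ℕ.^ a) ℕ.* (m ℕ.^ e))
    Y = fromℕ ((d ℕ.^ a') ℕ.* (m ℕ.^ e'))
    regroup : ∀ p q r s → (p ℕ.* q) ℕ.* (r ℕ.* s) ≡ (p ℕ.* s) ℕ.* (q ℕ.* r)
    regroup = solve-∀
    monomial-product : fromℕ ((d ℕ.^ (a ℕ.+ a')) ℕ.* (m ℕ.^ (e' ℕ.+ e))) ≡ X * Y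
    monomial-product = trans
      (cong fromℕ (trans (cong₂ ℕ._*_ (ℕP.^-distribˡ-+-* d a a') (ℕP.^-distribˡ-+-* m e' e))
                         (regroup (d ℕ.^ a) (d ℕ.^ a') (m ℕ.^ e') (m ℕ.^ e))))
      (fromℕ-* ((d ℕ.^ a) ℕ.* (m ℕ.^ e)) ((d ℕ.^ a') ℕ.* (m ℕ.^ e')))
    distribute : ∀ b S → (if b then (c * c') * (X * Y) else 0ℚ) + (c * X) * S
                       ≡ (c * X) * ((if b then c' * Y else 0ℚ) + S)
    distribute true  S = solve 5 (λ c c' X Y S → (c :* c') :* (X :* Y) :+ (c :* X) :* S
                                               := (c :* X) :* (c' :* Y :+ S)) refl c c' X Y S
    distribute false S = solve 3 (λ c X S → con 0ℚ :+ (c :* X) :* S := (c :* X) :* (con 0ℚ :+ S)) refl c X S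

  degm-scale : ∀ x P k → degm≤ P k → degm≤ (scaleMono x P) (k ℕ.+ proj₂ (proj₂ x))
  degm-scale x                  []                    k _       = tt
  degm-scale (c , a , e) ((c' , a' , e' , j) ∷ P) k (le , p) =
    ℕP.+-monoˡ-≤ e le , degm-scale (c , a , e) P k p

  shiftQ : Poly3 → Poly3
  shiftQ = List.map (λ { (c , ed , em , eq) → (c , ed , em , suc eq) })

  polySeries-shift : ∀ P d m → polySeries (shiftQ P) d m ≐ shiftS (polySeries P d m)
  polySeries-shift []                      d m zero    = refl
  polySeries-shift []                      d m (suc k) = refl
  polySeries-shift ((c , ed , em , eq) ∷ P) d m zero    =
    trans (ℚP.+-identityˡ (polySeries (shiftQ P) d m zero)) (polySeries-shift P d m zero)
  polySeries-shift ((c , ed , em , eq) ∷ P) d m (suc k) =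
    cong ((if eq ≡ᵇ k then c * fromℕ ((d ℕ.^ ed) ℕ.* (m ℕ.^ em)) else 0ℚ) +_) (polySeries-shift P d m (suc k))

  degm-shift : ∀ P k → degm≤ P k → degm≤ (shiftQ P) k
  degm-shift []                      k _       = tt
  degm-shift ((c , ed , em , eq) ∷ P) k (e , p) = e , degm-shift P k p

  hornerSeries : List Poly3 → ℕ → ℕ → Series
  hornerSeries []       d m = zeroS
  hornerSeries (N ∷ Ns) d m = polySeries N d m ⊕ conv (invD d) (hornerSeries Ns d m)

  -- Rank K: entry j has m-degree ≤ K - j, and there are at most K+1 entries.
  HasRank : ℕ → List Poly3 → Set
  HasRank K       []            = ⊤
  HasRank zero    (N ∷ [])      = degm≤ N 0
  HasRank zero    (N ∷ _ ∷ _)   = ⊥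
  HasRank (suc K) (N ∷ Ns)      = degm≤ N (suc K) × HasRank K Ns

  PartialFractions : ℕ → (ℕ → ℕ → Series) → Set
  PartialFractions K f = Σ (List Poly3) λ Ns → HasRank K Ns × (∀ d m → f d m ≐ hornerSeries Ns d m)

  HasRank-single : ∀ K N → degm≤ N K → HasRank K (N ∷ [])
  HasRank-single zero    N p = p
  HasRank-single (suc K) N p = p , tt

  HasRank-weaken : ∀ {K K'} Ns → K ℕ.≤ K' → HasRank K Ns → HasRank K' Ns
  HasRank-weaken []                           _         _        = tt
  HasRank-weaken {zero}  {zero}   (N ∷ [])    _         p        = p
  HasRank-weaken {zero}  {suc K'} (N ∷ [])    _         p        = degm-weaken N z≤n p , tt
  HasRank-weaken {suc K} {suc K'} (N ∷ Ns)    (s≤s le)  (p , ps) = degm-weaken N (s≤s le) p , HasRank-weaken Ns le ps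

  addHorner : List Poly3 → List Poly3 → List Poly3
  addHorner []       Ms       = Ms
  addHorner (N ∷ Ns) []       = N ∷ Ns
  addHorner (N ∷ Ns) (M ∷ Ms) = (N ++ M) ∷ addHorner Ns Ms

  hornerSeries-add : ∀ Ns Ms d m → hornerSeries (addHorner Ns Ms) d m ≐ (hornerSeries Ns d m ⊕ hornerSeries Ms d m)
  hornerSeries-add []       Ms       d m k = sym (ℚP.+-identityˡ (hornerSeries Ms d m k))
  hornerSeries-add (N ∷ Ns) []       d m k = sym (ℚP.+-identityʳ (hornerSeries (N ∷ Ns) d m k))
  hornerSeries-add (N ∷ Ns) (M ∷ Ms) d m k =
    trans (cong₂ _+_ (polySeries-++ N M d m k)
            (trans (conv-congʳ (invD d) (hornerSeries-add Ns Ms d m) k)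
                   (conv-+ʳ (invD d) (hornerSeries Ns d m) (hornerSeries Ms d m) k)))
          (solve 4 (λ a b c e → (a :+ b) :+ (c :+ e) := (a :+ c) :+ (b :+ e)) refl
            (polySeries N d m k) (polySeries M d m k)
            (conv (invD d) (hornerSeries Ns d m) k) (conv (invD d) (hornerSeries Ms d m) k))

  HasRank-add : ∀ K Ns Ms → HasRank K Ns → HasRank K Ms → HasRank K (addHorner Ns Ms)
  HasRank-add K       []       Ms       _        q        = q
  HasRank-add zero    (N ∷ Ns) []       p        _        = p
  HasRank-add (suc K) (N ∷ Ns) []       p        _        = p
  HasRank-add zero    (N ∷ []) (M ∷ []) p        q        = degm-++ N M 0 p q
  HasRank-add (suc K) (N ∷ Ns) (M ∷ Ms) (p , ps) (q , qs) = degm-++ N M (suc K) p q , HasRank-add K Ns Ms ps qs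

  hornerSeries-scale : ∀ x Ns d m → hornerSeries (List.map (scaleMono x) Ns) d m ≐ (evalParam x d m · hornerSeries Ns d m)
  hornerSeries-scale x []       d m k = sym (ℚP.*-zeroʳ (evalParam x d m))
  hornerSeries-scale x (N ∷ Ns) d m k =
    trans (cong₂ _+_ (polySeries-scale x N d m k)
            (trans (conv-congʳ (invD d) (hornerSeries-scale x Ns d m) k)
                   (conv-·ʳ (evalParam x d m) (invD d) (hornerSeries Ns d m) k)))
          (sym (ℚP.*-distribˡ-+ (evalParam x d m) _ _))

  HasRank-scale : ∀ K x Ns → HasRank K Ns → HasRank (K ℕ.+ proj₂ (proj₂ x)) (List.map (scaleMono x) Ns)
  HasRank-scale K       x []       _        = tt
  HasRank-scale zero    x (N ∷ []) p        = HasRank-single _ (scaleMono x N) (degm-scale x N 0 p)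
  HasRank-scale (suc K) x (N ∷ Ns) (p , ps) = degm-scale x N (suc K) p , HasRank-scale K x Ns ps

  hornerSeries-shift : ∀ Ns d m → hornerSeries (List.map shiftQ Ns) d m ≐ shiftS (hornerSeries Ns d m)
  hornerSeries-shift []       d m zero    = refl
  hornerSeries-shift []       d m (suc k) = refl
  hornerSeries-shift (N ∷ Ns) d m zero    =
    trans (cong₂ _+_ (polySeries-shift N d m 0)
            (trans (conv-congʳ (invD d) (hornerSeries-shift Ns d m) 0) (conv-shiftʳ (invD d) (hornerSeries Ns d m) 0)))
          (ℚP.+-identityˡ 0ℚ)
  hornerSeries-shift (N ∷ Ns) d m (suc k) =
    cong₂ _+_ (polySeries-shift N d m (suc k))
      (trans (conv-congʳ (invD d) (hornerSeries-shift Ns d m) (suc k)) (conv-shiftʳ (invD d) (hornerSeries Ns d m) (suc k)))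

  HasRank-shift : ∀ K Ns → HasRank K Ns → HasRank K (List.map shiftQ Ns)
  HasRank-shift K       []       _        = tt
  HasRank-shift zero    (N ∷ []) p        = degm-shift N 0 p
  HasRank-shift (suc K) (N ∷ Ns) (p , ps) = degm-shift N (suc K) p , HasRank-shift K Ns ps

  PF-resp : ∀ {K f g} → (∀ d m → f d m ≐ g d m) → PartialFractions K f → PartialFractions K g
  PF-resp e (Ns , rk , eq) = Ns , rk , λ d m k → trans (sym (e d m k)) (eq d m k)

  PF-zero : ∀ K → PartialFractions K (λ _ _ → zeroS)
  PF-zero K = [] , tt , λ _ _ _ → refl

  PF-weaken : ∀ {K K' f} → K ℕ.≤ K' → PartialFractions K f → PartialFractions K' f
  PF-weaken le (Ns , rk , eq) = Ns , HasRank-weaken Ns le rk , eq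

  PF-add : ∀ {K f g} → PartialFractions K f → PartialFractions K g → PartialFractions K (λ d m → f d m ⊕ g d m)
  PF-add {K} (Ns , rn , en) (Ms , rm , em) = addHorner Ns Ms , HasRank-add K Ns Ms rn rm ,
    λ d m k → trans (cong₂ _+_ (en d m k) (em d m k)) (sym (hornerSeries-add Ns Ms d m k))

  PF-scale : ∀ {K f} x → PartialFractions K f →
             PartialFractions (K ℕ.+ proj₂ (proj₂ x)) (λ d m → evalParam x d m · f d m)
  PF-scale {K} x (Ns , rn , en) = List.map (scaleMono x) Ns , HasRank-scale K x Ns rn ,
    λ d m k → trans (cong (evalParam x d m *_) (en d m k)) (sym (hornerSeries-scale x Ns d m k))

  PF-shift : ∀ {K f} → PartialFractions K f → PartialFractions K (λ d m → shiftS (f d m))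
  PF-shift {K} {f} (Ns , rn , en) = List.map shiftQ Ns , HasRank-shift K Ns rn , shifted
    where
    shifted : ∀ d m → shiftS (f d m) ≐ hornerSeries (List.map shiftQ Ns) d m
    shifted d m zero    = sym (hornerSeries-shift Ns d m zero)
    shifted d m (suc k) = trans (en d m k) (sym (hornerSeries-shift Ns d m (suc k)))

  PF-poly : ∀ K P → degm≤ P K → PartialFractions K (λ d m → polySeries P d m)
  PF-poly K P p = P ∷ [] , HasRank-single K P p ,
    λ d m k → sym (trans (cong (polySeries P d m k +_) (conv-0ʳ (invD d) k)) (ℚP.+-identityʳ _))

  OverD : ℕ → (ℕ → ℕ → Series) → Set
  OverD K f = Σ (List Poly3) λ Ns → HasRank K Ns × (∀ d m → f d m ≐ conv (invD d) (hornerSeries Ns d m))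

  OverD⇒PF : ∀ {K f} → OverD K f → PartialFractions (suc K) f
  OverD⇒PF (Ns , rn , en) = [] ∷ Ns , (tt , rn) , λ d m k → trans (en d m k) (sym (ℚP.+-identityˡ _))

  -- Reading off the numerators: 1/D times a Horner list of rank < L is the
  -- sum over j < L of  N_j / D^{j+1} , which is the shape of the theorem.

  nth : List Poly3 → ℕ → Poly3
  nth []       _       = []
  nth (N ∷ Ns) zero    = N
  nth (N ∷ Ns) (suc j) = nth Ns j

  HasRank-length : ∀ K Ns → HasRank K Ns → length Ns ℕ.≤ suc K
  HasRank-length K       []       _        = z≤n
  HasRank-length zero    (N ∷ []) _        = s≤s z≤n
  HasRank-length (suc K) (N ∷ Ns) (_ , ps) = s≤s (HasRank-length K Ns ps)

  HasRank-nth : ∀ K Ns → HasRank K Ns → ∀ j → degm≤ (nth Ns j) (K ℕ.∸ j)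
  HasRank-nth K       []       _        j       = tt
  HasRank-nth zero    (N ∷ []) p        zero    = p
  HasRank-nth zero    (N ∷ []) p        (suc j) = tt
  HasRank-nth (suc K) (N ∷ Ns) (p , _)  zero    = p
  HasRank-nth (suc K) (N ∷ Ns) (_ , ps) (suc j) = HasRank-nth K Ns ps j

  fraction : ℕ → ℕ → List Poly3 → ℕ → Series
  fraction d m Ns j = polySeries (nth Ns j) d m ⊛ (invD d ^S (j ℕ.+ 1))

  fraction-suc : ∀ d m N Ns j → conv (invD d) (fraction d m Ns j) ≐ fraction d m (N ∷ Ns) (suc j)
  fraction-suc d m N Ns j k = begin
    conv (invD d) (fraction d m Ns j) k
      ≡⟨ conv-congʳ (invD d) (⊛≐conv p X) k ⟩
    conv (invD d) (conv p X) k
      ≡⟨ sym (conv-assoc (invD d) p X k) ⟩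
    conv (conv (invD d) p) X k
      ≡⟨ conv-cong (conv-comm (invD d) p) (λ _ → refl) k ⟩
    conv (conv p (invD d)) X k
      ≡⟨ conv-assoc p (invD d) X k ⟩
    conv p (conv (invD d) X) k
      ≡⟨ conv-congʳ p (λ z → sym (^S-suc (invD d) (j ℕ.+ 1) z)) k ⟩
    conv p (invD d ^S (suc j ℕ.+ 1)) k
      ≡⟨ sym (⊛≐conv p (invD d ^S (suc j ℕ.+ 1)) k) ⟩
    fraction d m (N ∷ Ns) (suc j) k ∎
    where
    p = polySeries (nth Ns j) d m
    X = invD d ^S (j ℕ.+ 1)

  fraction-zero : ∀ d m N Ns → conv (invD d) (polySeries N d m) ≐ fraction d m (N ∷ Ns) 0
  fraction-zero d m N Ns k = sym (begin
    (polySeries N d m ⊛ (invD d ^S 1)) k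
      ≡⟨ ⊛≐conv (polySeries N d m) (invD d ^S 1) k ⟩
    conv (polySeries N d m) (invD d ^S 1) k
      ≡⟨ conv-congʳ (polySeries N d m) (λ i → trans (^S-suc (invD d) 0 i) (conv-oneʳ (invD d) i)) k ⟩
    conv (polySeries N d m) (invD d) k
      ≡⟨ conv-comm (polySeries N d m) (invD d) k ⟩
    conv (invD d) (polySeries N d m) k ∎)

  invD-horner : ∀ L Ns → length Ns ℕ.≤ L → ∀ d m →
    conv (invD d) (hornerSeries Ns d m) ≐ sumS {L} (λ k → fraction d m Ns (toℕ k))
  invD-horner-cons : ∀ L N Ns → length Ns ℕ.≤ L → ∀ d m →
    conv (invD d) (hornerSeries (N ∷ Ns) d m) ≐ sumS {suc L} (λ k → fraction d m (N ∷ Ns) (toℕ k))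
  invD-horner zero    []       _        d m = conv-0ʳ (invD d)
  invD-horner (suc L) (N ∷ Ns) (s≤s le) d m = invD-horner-cons L N Ns le d m
  invD-horner (suc L) []       _        d m n = begin
    conv (invD d) zeroS n
      ≡⟨ conv-congʳ (invD d) (λ k → sym (trans (cong (0ℚ +_) (conv-0ʳ (invD d) k)) (ℚP.+-identityʳ 0ℚ))) n ⟩
    conv (invD d) (hornerSeries ([] ∷ []) d m) n
      ≡⟨ invD-horner-cons L [] [] z≤n d m n ⟩
    sumS {suc L} (λ k → fraction d m ([] ∷ []) (toℕ k)) n
      ≡⟨ sumS-cong {suc L} {G = λ k → fraction d m ([] ∷ []) (toℕ k)}
           (λ k → ⊛-cong (λ i → cong (λ P → polySeries P d m i) (nth-[]∷[] (toℕ k))) (λ _ → refl)) n ⟩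
    sumS {suc L} (λ k → fraction d m [] (toℕ k)) n ∎
    where
    nth-[]∷[] : ∀ j → nth ([] ∷ []) j ≡ nth [] j
    nth-[]∷[] zero    = refl
    nth-[]∷[] (suc j) = refl
  invD-horner-cons L N Ns le d m n = begin
    conv (invD d) (polySeries N d m ⊕ conv (invD d) (hornerSeries Ns d m)) n
      ≡⟨ conv-+ʳ (invD d) (polySeries N d m) (conv (invD d) (hornerSeries Ns d m)) n ⟩
    conv (invD d) (polySeries N d m) n + conv (invD d) (conv (invD d) (hornerSeries Ns d m)) n
      ≡⟨ cong₂ _+_ (fraction-zero d m N Ns n) (begin
           conv (invD d) (conv (invD d) (hornerSeries Ns d m)) n
             ≡⟨ conv-congʳ (invD d) (invD-horner L Ns le d m) n ⟩
           conv (invD d) (sumS {L} (λ k → fraction d m Ns (toℕ k))) n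
             ≡⟨ conv-sumS {L} (invD d) (λ k → fraction d m Ns (toℕ k)) n ⟩
           sumS {L} (λ k → conv (invD d) (fraction d m Ns (toℕ k))) n
             ≡⟨ sumS-cong {L} {G = λ k → conv (invD d) (fraction d m Ns (toℕ k))} (λ k → fraction-suc d m N Ns (toℕ k)) n ⟩
           sumS {L} (λ k → fraction d m (N ∷ Ns) (toℕ (Fin.suc k))) n ∎) ⟩
    fraction d m (N ∷ Ns) 0 n + sumS {L} (λ k → fraction d m (N ∷ Ns) (toℕ (Fin.suc k))) n
      ≡⟨ sym (sumS-suc {L} (λ k → fraction d m (N ∷ Ns) (toℕ k)) n) ⟩
    sumS {suc L} (λ k → fraction d m (N ∷ Ns) (toℕ k)) n ∎

module Polynomials where
  -- Polynomials with rational coefficients in five variables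
  --   h (a column height), d, m, x (standing for σ_m(I)) and y (for |I|),
  -- as lists of monomials, with evaluation, products and powers, and a
  -- grading by an additive weight on monomials.

  open Rational using (_+_; _*_)
  open NatCast

  data Mono : Set where
    -- mono c a b e f g  is  c h^a d^b m^e x^f y^g .
    mono : ℚ → ℕ → ℕ → ℕ → ℕ → ℕ → Mono

  Poly : Set
  Poly = List Mono

  data Env : Set where
    env : ℚ → ℚ → ℚ → ℚ → ℚ → Env

  monomial : Env → ℕ → ℕ → ℕ → ℕ → ℕ → ℚ
  monomial (env h d m x y) a b e f g = h ^ a * (d ^ b * (m ^ e * (x ^ f * y ^ g)))

  evalM : Env → Mono → ℚ
  evalM ρ (mono c a b e f g) = c * monomial ρ a b e f g

  evalP : Env → Poly → ℚ
  evalP ρ []      = 0ℚ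
  evalP ρ (u ∷ p) = evalM ρ u + evalP ρ p

  mulM : Mono → Mono → Mono
  mulM (mono c a b e f g) (mono c' a' b' e' f' g') =
    mono (c * c') (a ℕ.+ a') (b ℕ.+ b') (e ℕ.+ e') (f ℕ.+ f') (g ℕ.+ g')

  mulP : Poly → Poly → Poly
  mulP p q = concatMap (λ u → List.map (mulM u) q) p

  constP : ℚ → Poly
  constP c = mono c 0 0 0 0 0 ∷ []

  scaleP : ℚ → Poly → Poly
  scaleP c p = mulP (constP c) p

  powP : Poly → ℕ → Poly
  powP p zero    = constP 1ℚ
  powP p (suc k) = mulP p (powP p k)

  varH varD varM varX varY : Poly
  varH = mono 1ℚ 1 0 0 0 0 ∷ []
  varD = mono 1ℚ 0 1 0 0 0 ∷ []
  varM = mono 1ℚ 0 0 1 0 0 ∷ []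
  varX = mono 1ℚ 0 0 0 1 0 ∷ []
  varY = mono 1ℚ 0 0 0 0 1 ∷ []

  interchange : ∀ p q r s → (p * q) * (r * s) ≡ (p * r) * (q * s)
  interchange = solve 4 (λ p q r s → (p :* q) :* (r :* s) := (p :* r) :* (q :* s)) refl

  monomial-+ : ∀ ρ a b e f g a' b' e' f' g' →
    monomial ρ (a ℕ.+ a') (b ℕ.+ b') (e ℕ.+ e') (f ℕ.+ f') (g ℕ.+ g') ≡ monomial ρ a b e f g * monomial ρ a' b' e' f' g'
  monomial-+ (env h d m x y) a b e f g a' b' e' f' g'
    rewrite ^-homo-* h a a' | ^-homo-* d b b' | ^-homo-* m e e' | ^-homo-* x f f' | ^-homo-* y g g' =
    trans (cong (λ z → (h ^ a * h ^ a') * ((d ^ b * d ^ b') * ((m ^ e * m ^ e') * z))) (interchange (x ^ f) (x ^ f') (y ^ g) (y ^ g')))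
    (trans (cong (λ z → (h ^ a * h ^ a') * ((d ^ b * d ^ b') * z)) (interchange (m ^ e) (m ^ e') _ _))
    (trans (cong (λ z → (h ^ a * h ^ a') * z) (interchange (d ^ b) (d ^ b') _ _))
    (interchange (h ^ a) (h ^ a') _ _)))

  evalM-mul : ∀ ρ u v → evalM ρ (mulM u v) ≡ evalM ρ u * evalM ρ v
  evalM-mul ρ (mono c a b e f g) (mono c' a' b' e' f' g') =
    trans (cong ((c * c') *_) (monomial-+ ρ a b e f g a' b' e' f' g')) (interchange c c' _ _)

  evalP-++ : ∀ ρ p q → evalP ρ (p ++ q) ≡ evalP ρ p + evalP ρ q
  evalP-++ ρ []      q = sym (ℚP.+-identityˡ (evalP ρ q))
  evalP-++ ρ (u ∷ p) q =
    trans (cong (evalM ρ u +_) (evalP-++ ρ p q)) (sym (ℚP.+-assoc (evalM ρ u) (evalP ρ p) (evalP ρ q)))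

  evalP-mul : ∀ ρ p q → evalP ρ (mulP p q) ≡ evalP ρ p * evalP ρ q
  evalP-mul ρ []      q = sym (ℚP.*-zeroˡ (evalP ρ q))
  evalP-mul ρ (u ∷ p) q = begin
    evalP ρ (List.map (mulM u) q ++ mulP p q)
      ≡⟨ evalP-++ ρ (List.map (mulM u) q) (mulP p q) ⟩
    evalP ρ (List.map (mulM u) q) + evalP ρ (mulP p q)
      ≡⟨ cong₂ _+_ (evalP-map-mulM q) (evalP-mul ρ p q) ⟩
    evalM ρ u * evalP ρ q + evalP ρ p * evalP ρ q
      ≡⟨ sym (ℚP.*-distribʳ-+ (evalP ρ q) (evalM ρ u) (evalP ρ p)) ⟩
    (evalM ρ u + evalP ρ p) * evalP ρ q ∎
    where
    evalP-map-mulM : ∀ q → evalP ρ (List.map (mulM u) q) ≡ evalM ρ u * evalP ρ q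
    evalP-map-mulM []      = sym (ℚP.*-zeroʳ (evalM ρ u))
    evalP-map-mulM (v ∷ q) = trans (cong₂ _+_ (evalM-mul ρ u v) (evalP-map-mulM q))
                                   (sym (ℚP.*-distribˡ-+ (evalM ρ u) (evalM ρ v) (evalP ρ q)))

  evalP-const : ∀ ρ c → evalP ρ (constP c) ≡ c
  evalP-const (env h d m x y) c =
    solve 1 (λ c → c :* (con 1ℚ :* (con 1ℚ :* (con 1ℚ :* (con 1ℚ :* con 1ℚ)))) :+ con 0ℚ := c) refl c

  evalP-pow : ∀ ρ p k → evalP ρ (powP p k) ≡ evalP ρ p ^ k
  evalP-pow ρ p zero    = evalP-const ρ 1ℚ
  evalP-pow ρ p (suc k) = trans (evalP-mul ρ p (powP p k)) (cong (evalP ρ p *_) (evalP-pow ρ p k))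

  evalP-scale : ∀ ρ c p → evalP ρ (scaleP c p) ≡ c * evalP ρ p
  evalP-scale ρ c p = trans (evalP-mul ρ (constP c) p) (cong (_* evalP ρ p) (evalP-const ρ c))

  evalP-varH : ∀ h d m x y → evalP (env h d m x y) varH ≡ h
  evalP-varH h d m x y =
    solve 1 (λ h → con 1ℚ :* ((h :* con 1ℚ) :* (con 1ℚ :* (con 1ℚ :* (con 1ℚ :* con 1ℚ)))) :+ con 0ℚ := h) refl h
  evalP-varD : ∀ h d m x y → evalP (env h d m x y) varD ≡ d
  evalP-varD h d m x y =
    solve 1 (λ d → con 1ℚ :* (con 1ℚ :* ((d :* con 1ℚ) :* (con 1ℚ :* (con 1ℚ :* con 1ℚ)))) :+ con 0ℚ := d) refl d
  evalP-varM : ∀ h d m x y → evalP (env h d m x y) varM ≡ m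
  evalP-varM h d m x y =
    solve 1 (λ m → con 1ℚ :* (con 1ℚ :* (con 1ℚ :* ((m :* con 1ℚ) :* (con 1ℚ :* con 1ℚ)))) :+ con 0ℚ := m) refl m
  evalP-varX : ∀ h d m x y → evalP (env h d m x y) varX ≡ x
  evalP-varX h d m x y =
    solve 1 (λ x → con 1ℚ :* (con 1ℚ :* (con 1ℚ :* (con 1ℚ :* ((x :* con 1ℚ) :* con 1ℚ)))) :+ con 0ℚ := x) refl x
  evalP-varY : ∀ h d m x y → evalP (env h d m x y) varY ≡ y
  evalP-varY h d m x y =
    solve 1 (λ y → con 1ℚ :* (con 1ℚ :* (con 1ℚ :* (con 1ℚ :* (con 1ℚ :* (y :* con 1ℚ))))) :+ con 0ℚ := y) refl y

  -- For an additive weight on monomials (constants have weight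
  -- 0),  AllW P p  says that every monomial of p has a weight satisfying P.
  -- The main use: a power or product of polynomials equals the power or
  -- product of their top-weight parts plus a polynomial of smaller weight.

  module Graded (wt : Mono → ℕ) (wt-mul : ∀ u v → wt (mulM u v) ≡ wt u ℕ.+ wt v)
                (wt-const : ∀ c → wt (mono c 0 0 0 0 0) ≡ 0) where

    AllW : (ℕ → Set) → Poly → Set
    AllW P []      = ⊤
    AllW P (u ∷ p) = P (wt u) × AllW P p

    AllW-++ : ∀ {P : ℕ → Set} p q → AllW P p → AllW P q → AllW P (p ++ q)
    AllW-++ []      q _       b = b
    AllW-++ (u ∷ p) q (x , a) b = x , AllW-++ p q a b

    AllW-map : ∀ {P Q : ℕ → Set} → (∀ {x} → P x → Q x) → ∀ p → AllW P p → AllW Q p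
    AllW-map f []      _       = tt
    AllW-map f (u ∷ p) (x , a) = f x , AllW-map f p a

    AllW-mul : ∀ {P Q R : ℕ → Set} → (∀ {x y} → P x → Q y → R (x ℕ.+ y)) →
               ∀ p q → AllW P p → AllW Q q → AllW R (mulP p q)
    AllW-mul {P} {Q} {R} f []      q _        _ = tt
    AllW-mul {P} {Q} {R} f (u ∷ p) q (pu , a) b =
      AllW-++ (List.map (mulM u) q) (mulP p q) (row q b) (AllW-mul f p q a b)
      where
      row : ∀ q → AllW Q q → AllW R (List.map (mulM u) q)
      row []      _        = tt
      row (v ∷ q) (qv , c) = subst R (sym (wt-mul u v)) (f pu qv) , row q c

    AllW-const : ∀ {P : ℕ → Set} c → P 0 → AllW P (constP c)
    AllW-const {P} c p0 = subst P (sym (wt-const c)) p0 , tt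

    AllW-pow : ∀ k p α → AllW (ℕ._≤ k) p → AllW (ℕ._≤ α ℕ.* k) (powP p α)
    AllW-pow k p zero    _ = AllW-const {ℕ._≤ 0} 1ℚ z≤n
    AllW-pow k p (suc α) a = AllW-mul ℕP.+-mono-≤ p (powP p α) a (AllW-pow k p α a)

    AllW-scale : ∀ {P : ℕ → Set} c p → AllW P p → AllW P (scaleP c p)
    AllW-scale {P} c p a = AllW-mul {P = _≡ 0} {Q = P} (λ { refl q → q }) (constP c) p (wt-const c , tt) a

    <+≤ : ∀ {x y k l} → x ℕ.< k → y ℕ.≤ l → x ℕ.+ y ℕ.< k ℕ.+ l
    <+≤ = ℕP.+-mono-≤

    ≤+< : ∀ {x y k l} → x ℕ.≤ k → y ℕ.< l → x ℕ.+ y ℕ.< k ℕ.+ l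
    ≤+< {x} {y} {k} {l} p q = subst (ℕ._≤ k ℕ.+ l) (ℕP.+-suc x y) (ℕP.+-mono-≤ p q)

    pow-leading : ∀ k α A L → AllW (ℕ._≤ k) A → AllW (ℕ._< k) L →
      Σ Poly λ R → AllW (ℕ._< α ℕ.* k) R × (∀ ρ → evalP ρ (powP (A ++ L) α) ≡ evalP ρ (powP A α) + evalP ρ R)
    pow-leading k zero    A L a l = [] , tt , λ ρ → sym (ℚP.+-identityʳ _)
    pow-leading k (suc α) A L a l with pow-leading k α A L a l
    ... | R , r , e = mulP L (powP A α) ++ mulP (A ++ L) R ,
        AllW-++ (mulP L (powP A α)) (mulP (A ++ L) R)
          (AllW-mul <+≤ L (powP A α) l (AllW-pow k A α a))
          (AllW-mul ≤+< (A ++ L) R (AllW-++ A L a (AllW-map ℕP.<⇒≤ L l)) r) ,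
        λ ρ → begin
          evalP ρ (mulP (A ++ L) (powP (A ++ L) α))
            ≡⟨ trans (evalP-mul ρ (A ++ L) _) (cong₂ _*_ (evalP-++ ρ A L) (e ρ)) ⟩
          (evalP ρ A + evalP ρ L) * (evalP ρ (powP A α) + evalP ρ R)
            ≡⟨ solve 4 (λ a l q r → (a :+ l) :* (q :+ r) := a :* q :+ (l :* q :+ (a :+ l) :* r)) refl
                 (evalP ρ A) (evalP ρ L) (evalP ρ (powP A α)) (evalP ρ R) ⟩
          evalP ρ A * evalP ρ (powP A α) + (evalP ρ L * evalP ρ (powP A α) + (evalP ρ A + evalP ρ L) * evalP ρ R)
            ≡⟨ sym (cong₂ _+_ (evalP-mul ρ A (powP A α))
                     (trans (evalP-++ ρ (mulP L (powP A α)) _)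
                       (cong₂ _+_ (evalP-mul ρ L _)
                         (trans (evalP-mul ρ (A ++ L) R) (cong (_* evalP ρ R) (evalP-++ ρ A L)))))) ⟩
          evalP ρ (powP A (suc α)) + evalP ρ (mulP L (powP A α) ++ mulP (A ++ L) R) ∎

    mul-leading : ∀ k₁ k₂ M₁ R₁ M₂ R₂ →
      AllW (ℕ._≤ k₁) M₁ → AllW (ℕ._< k₁) R₁ → AllW (ℕ._≤ k₂) M₂ → AllW (ℕ._< k₂) R₂ →
      Σ Poly λ R → AllW (ℕ._< k₁ ℕ.+ k₂) R ×
        (∀ ρ → evalP ρ (M₁ ++ R₁) * evalP ρ (M₂ ++ R₂) ≡ evalP ρ (mulP M₁ M₂) + evalP ρ R)
    mul-leading k₁ k₂ M₁ R₁ M₂ R₂ m₁ r₁ m₂ r₂ =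
      mulP R₁ (M₂ ++ R₂) ++ mulP M₁ R₂ ,
      AllW-++ (mulP R₁ (M₂ ++ R₂)) (mulP M₁ R₂)
        (AllW-mul <+≤ R₁ (M₂ ++ R₂) r₁ (AllW-++ M₂ R₂ m₂ (AllW-map ℕP.<⇒≤ R₂ r₂)))
        (AllW-mul ≤+< M₁ R₂ m₁ r₂) ,
      λ ρ → begin
        evalP ρ (M₁ ++ R₁) * evalP ρ (M₂ ++ R₂)
          ≡⟨ cong₂ _*_ (evalP-++ ρ M₁ R₁) (evalP-++ ρ M₂ R₂) ⟩
        (evalP ρ M₁ + evalP ρ R₁) * (evalP ρ M₂ + evalP ρ R₂)
          ≡⟨ solve 4 (λ a b c e → (a :+ b) :* (c :+ e) := a :* c :+ (b :* (c :+ e) :+ a :* e)) refl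
               (evalP ρ M₁) (evalP ρ R₁) (evalP ρ M₂) (evalP ρ R₂) ⟩
        evalP ρ M₁ * evalP ρ M₂ + (evalP ρ R₁ * (evalP ρ M₂ + evalP ρ R₂) + evalP ρ M₁ * evalP ρ R₂)
          ≡⟨ sym (cong₂ _+_ (evalP-mul ρ M₁ M₂)
                   (trans (evalP-++ ρ (mulP R₁ (M₂ ++ R₂)) _)
                     (cong₂ _+_ (trans (evalP-mul ρ R₁ _) (cong (evalP ρ R₁ *_) (evalP-++ ρ M₂ R₂)))
                                (evalP-mul ρ M₁ R₂)))) ⟩
        evalP ρ (mulP M₁ M₂) + evalP ρ (mulP R₁ (M₂ ++ R₂) ++ mulP M₁ R₂) ∎

module PowerSums where
  -- Summing a polynomial over the column height h = 1, …, d
  -- gives a polynomial in d (Faulhaber), and this elimination of h does not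
  -- increase the weight  e + 2f + g  of a monomial  m^e x^f y^g .

  open Rational using (_+_; _*_; -_)
  open NatCast
  open Polynomials

  Σ₁ : ℕ → (ℕ → ℚ) → ℚ
  Σ₁ zero    f = 0ℚ
  Σ₁ (suc d) f = Σ₁ d f + f (suc d)

  Σ₁-cong : ∀ d {f g} → (∀ h → f h ≡ g h) → Σ₁ d f ≡ Σ₁ d g
  Σ₁-cong zero    e = refl
  Σ₁-cong (suc d) e = cong₂ _+_ (Σ₁-cong d e) (e (suc d))

  Σ₁-+ : ∀ d f g → Σ₁ d (λ h → f h + g h) ≡ Σ₁ d f + Σ₁ d g
  Σ₁-+ zero    f g = sym (ℚP.+-identityˡ 0ℚ)
  Σ₁-+ (suc d) f g rewrite Σ₁-+ d f g =
    solve 4 (λ a b c e → (a :+ b) :+ (c :+ e) := (a :+ c) :+ (b :+ e)) refl (Σ₁ d f) (Σ₁ d g) (f (suc d)) (g (suc d))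

  Σ₁-* : ∀ d c f → Σ₁ d (λ h → c * f h) ≡ c * Σ₁ d f
  Σ₁-* zero    c f = sym (ℚP.*-zeroʳ c)
  Σ₁-* (suc d) c f rewrite Σ₁-* d c f = sym (ℚP.*-distribˡ-+ c (Σ₁ d f) (f (suc d)))

  Σ₁-*ʳ : ∀ d c f → Σ₁ d (λ h → f h * c) ≡ Σ₁ d f * c
  Σ₁-*ʳ d c f = trans (Σ₁-cong d (λ h → ℚP.*-comm (f h) c)) (trans (Σ₁-* d c f) (ℚP.*-comm c (Σ₁ d f)))

  Σ₁-const : ∀ d c → Σ₁ d (λ _ → c) ≡ fromℕ d * c
  Σ₁-const zero    c = sym (ℚP.*-zeroˡ c)
  Σ₁-const (suc d) c = trans (cong (_+ c) (Σ₁-const d c))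
    (trans (solve 2 (λ D c → D :* c :+ c := (con 1ℚ :+ D) :* c) refl (fromℕ d) c)
           (cong (_* c) (sym (fromℕ-+ 1 d))))

  Σ₁-suc : ∀ d (f : ℕ → ℚ) → Σ₁ (suc d) f ≡ f 1 + Σ₁ d (λ h → f (suc h))
  Σ₁-suc zero    f = trans (ℚP.+-identityˡ (f 1)) (sym (ℚP.+-identityʳ (f 1)))
  Σ₁-suc (suc d) f rewrite Σ₁-suc d f = ℚP.+-assoc (f 1) (Σ₁ d (λ h → f (suc h))) (f (suc (suc d)))

  telescope : ∀ d E → Σ₁ d (λ h → fromℕ h ^ suc E + - (fromℕ h + - 1ℚ) ^ suc E) ≡ fromℕ d ^ suc E
  telescope zero    E = sym (ℚP.*-zeroˡ (0ℚ ^ E))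
  telescope (suc d) E =
    trans (cong₂ (λ a b → a + (fromℕ (suc d) ^ suc E + - b ^ suc E)) (telescope d E) (fromℕ-pred d))
          (solve 2 (λ p q → p :+ (q :+ :- p) := q) refl (fromℕ d ^ suc E) (fromℕ (suc d) ^ suc E))

  weight : Mono → ℕ
  weight (mono c a b e f g) = e ℕ.+ (f ℕ.+ (f ℕ.+ g))

  weight-mul : ∀ u v → weight (mulM u v) ≡ weight u ℕ.+ weight v
  weight-mul (mono c a b e f g) (mono c' a' b' e' f' g') = regroup e f g e' f' g'
    where
    regroup : ∀ e f g e' f' g' → (e ℕ.+ e') ℕ.+ ((f ℕ.+ f') ℕ.+ ((f ℕ.+ f') ℕ.+ (g ℕ.+ g')))
                                ≡ (e ℕ.+ (f ℕ.+ (f ℕ.+ g))) ℕ.+ (e' ℕ.+ (f' ℕ.+ (f' ℕ.+ g')))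
    regroup = solve-∀

  hdeg : Mono → ℕ
  hdeg (mono c a b e f g) = a

  hdeg-mul : ∀ u v → hdeg (mulM u v) ≡ hdeg u ℕ.+ hdeg v
  hdeg-mul (mono c a b e f g) (mono c' a' b' e' f' g') = refl

  module Wt = Graded weight weight-mul (λ c → refl)
  module Hd = Graded hdeg hdeg-mul (λ c → refl)

  -- The binomial remainder r_n(h), of h-degree < n and weight 0:
  --   h^{n+1} = (h-1)^{n+1} + (n+1) h^n + r_n(h).

  hMinus1 : Poly
  hMinus1 = varH ++ constP (- 1ℚ)

  remainder : ℕ → Poly
  remainder zero    = []
  remainder (suc n) = scaleP (fromℕ (suc n) * - 1ℚ) (powP varH n) ++ mulP hMinus1 (remainder n)

  remainder-eval : ∀ h d m x y n → evalP (env h d m x y) (remainder (suc n))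
                   ≡ fromℕ (suc n) * - 1ℚ * h ^ n + (h + - 1ℚ) * evalP (env h d m x y) (remainder n)
  remainder-eval h d m x y n =
    trans (evalP-++ ρ (scaleP (fromℕ (suc n) * - 1ℚ) (powP varH n)) (mulP hMinus1 (remainder n)))
      (cong₂ _+_ (trans (evalP-scale ρ (fromℕ (suc n) * - 1ℚ) (powP varH n))
                        (cong (fromℕ (suc n) * - 1ℚ *_) (trans (evalP-pow ρ varH n) (cong (_^ n) (evalP-varH h d m x y)))))
                 (trans (evalP-mul ρ hMinus1 (remainder n))
                        (cong (_* evalP ρ (remainder n))
                          (trans (evalP-++ ρ varH (constP (- 1ℚ))) (cong₂ _+_ (evalP-varH h d m x y) (evalP-const ρ (- 1ℚ)))))))
    where ρ = env h d m x y

  binomial-remainder : ∀ h d m x y n →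
    h ^ suc n ≡ (h + - 1ℚ) ^ suc n + (fromℕ (suc n) * h ^ n + evalP (env h d m x y) (remainder n))
  binomial-remainder h d m x y zero =
    solve 1 (λ h → h :* con 1ℚ := (h :+ :- con 1ℚ) :* con 1ℚ :+ (con 1ℚ :* con 1ℚ :+ con 0ℚ)) refl h
  binomial-remainder h d m x y (suc n) = sym (begin
    b * b ^ suc n + (fromℕ (suc (suc n)) * h ^ suc n + evalP ρ (remainder (suc n)))
      ≡⟨ cong₂ (λ z w → b * z + w) previous
           (cong₂ (λ z w → z * h ^ suc n + w) (fromℕ-+ 1 (suc n)) (remainder-eval h d m x y n)) ⟩
    b * (h ^ suc n + - (N * h ^ n + r)) + ((1ℚ + N) * h ^ suc n + (N * - 1ℚ * h ^ n + b * r))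
      ≡⟨ solve 4 (λ h P N r → (h :+ :- con 1ℚ) :* (h :* P :+ :- (N :* P :+ r))
                              :+ ((con 1ℚ :+ N) :* (h :* P) :+ (N :* :- con 1ℚ :* P :+ (h :+ :- con 1ℚ) :* r))
                              := h :* (h :* P)) refl h (h ^ n) N r ⟩
    h * h ^ suc n ∎)
    where
    ρ = env h d m x y
    b = h + - 1ℚ
    N = fromℕ (suc n)
    r = evalP ρ (remainder n)
    previous : b ^ suc n ≡ h ^ suc n + - (N * h ^ n + r)
    previous = trans (solve 2 (λ B Q → B := (B :+ Q) :+ :- Q) refl (b ^ suc n) (N * h ^ n + r))
                     (cong (_+ - (N * h ^ n + r)) (sym (binomial-remainder h d m x y n)))

  remainder-hdeg : ∀ n → Hd.AllW (ℕ._< n) (remainder n)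
  remainder-hdeg zero    = tt
  remainder-hdeg (suc n) =
    Hd.AllW-++ (scaleP (fromℕ (suc n) * - 1ℚ) (powP varH n)) (mulP hMinus1 (remainder n))
      (Hd.AllW-scale (fromℕ (suc n) * - 1ℚ) (powP varH n)
        (Hd.AllW-map (λ {x} le → s≤s (subst (x ℕ.≤_) (ℕP.*-identityʳ n) le)) (powP varH n)
                     (Hd.AllW-pow 1 varH n (ℕP.≤-refl , tt))))
      (Hd.AllW-mul Hd.≤+< hMinus1 (remainder n) (ℕP.≤-refl , z≤n , tt) (remainder-hdeg n))

  remainder-weight : ∀ n → Wt.AllW (ℕ._≤ 0) (remainder n)
  remainder-weight zero    = tt
  remainder-weight (suc n) =
    Wt.AllW-++ (scaleP (fromℕ (suc n) * - 1ℚ) (powP varH n)) (mulP hMinus1 (remainder n))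
      (Wt.AllW-scale (fromℕ (suc n) * - 1ℚ) (powP varH n)
        (Wt.AllW-map (λ {x} le → subst (x ℕ.≤_) (ℕP.*-zeroʳ n) le) (powP varH n)
                     (Wt.AllW-pow 0 varH n (z≤n , tt))))
      (Wt.AllW-mul ℕP.+-mono-≤ hMinus1 (remainder n) (z≤n , z≤n , tt) (remainder-weight n))

  power-sum-identity : ∀ d D m x y E →
    fromℕ (suc E) * Σ₁ d (λ h → fromℕ h ^ E)
      ≡ fromℕ d ^ suc E + - Σ₁ d (λ h → evalP (env (fromℕ h) D m x y) (remainder E))
  power-sum-identity d D m x y E = begin
    N * Σ₁ d (λ h → fromℕ h ^ E)
      ≡⟨ solve 2 (λ S T → S := S :+ T :+ :- T) refl (N * Σ₁ d (λ h → fromℕ h ^ E)) (Σ₁ d R) ⟩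
    N * Σ₁ d (λ h → fromℕ h ^ E) + Σ₁ d R + - Σ₁ d R
      ≡⟨ cong (λ z → z + Σ₁ d R + - Σ₁ d R) (sym (Σ₁-* d N (λ h → fromℕ h ^ E))) ⟩
    Σ₁ d (λ h → N * fromℕ h ^ E) + Σ₁ d R + - Σ₁ d R
      ≡⟨ cong (_+ - Σ₁ d R) (sym (Σ₁-+ d (λ h → N * fromℕ h ^ E) R)) ⟩
    Σ₁ d (λ h → N * fromℕ h ^ E + R h) + - Σ₁ d R
      ≡⟨ cong (_+ - Σ₁ d R) (Σ₁-cong d difference) ⟩
    Σ₁ d (λ h → fromℕ h ^ suc E + - (fromℕ h + - 1ℚ) ^ suc E) + - Σ₁ d R
      ≡⟨ cong (_+ - Σ₁ d R) (telescope d E) ⟩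
    fromℕ d ^ suc E + - Σ₁ d R ∎
    where
    N = fromℕ (suc E)
    R : ℕ → ℚ
    R h = evalP (env (fromℕ h) D m x y) (remainder E)
    difference : ∀ h → N * fromℕ h ^ E + R h ≡ fromℕ h ^ suc E + - (fromℕ h + - 1ℚ) ^ suc E
    difference h = trans (solve 2 (λ B Q → Q := B :+ Q :+ :- B) refl ((fromℕ h + - 1ℚ) ^ suc E) (N * fromℕ h ^ E + R h))
                         (cong (_+ - (fromℕ h + - 1ℚ) ^ suc E) (sym (binomial-remainder (fromℕ h) D m x y E)))

  HSum : Poly → Set
  HSum p = Σ Poly λ q → (∀ k → Wt.AllW (ℕ._< k) p → Wt.AllW (ℕ._< k) q) ×
    (∀ hh d m x y → evalP (env hh (fromℕ d) m x y) q ≡ Σ₁ d (λ h → evalP (env (fromℕ h) (fromℕ d) m x y) p))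

  HSum-[] : HSum []
  HSum-[] = [] , (λ _ _ → tt) , λ _ d _ _ _ → sym (trans (Σ₁-const d 0ℚ) (ℚP.*-zeroʳ (fromℕ d)))

  HSum-++ : ∀ p p' → HSum p → HSum p' → HSum (p ++ p')
  HSum-++ p p' (q , wq , eq) (q' , wq' , eq') = q ++ q' ,
    (λ k a → Wt.AllW-++ q q' (wq k (proj₁ (split p a))) (wq' k (proj₂ (split p a)))) ,
    λ hh d m x y → let at h = env (fromℕ h) (fromℕ d) m x y in begin
      evalP (env hh (fromℕ d) m x y) (q ++ q')
        ≡⟨ evalP-++ (env hh (fromℕ d) m x y) q q' ⟩
      evalP (env hh (fromℕ d) m x y) q + evalP (env hh (fromℕ d) m x y) q'
        ≡⟨ cong₂ _+_ (eq hh d m x y) (eq' hh d m x y) ⟩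
      Σ₁ d (λ h → evalP (at h) p) + Σ₁ d (λ h → evalP (at h) p')
        ≡⟨ sym (Σ₁-+ d (λ h → evalP (at h) p) (λ h → evalP (at h) p')) ⟩
      Σ₁ d (λ h → evalP (at h) p + evalP (at h) p')
        ≡⟨ Σ₁-cong d (λ h → sym (evalP-++ (at h) p p')) ⟩
      Σ₁ d (λ h → evalP (at h) (p ++ p')) ∎
    where
    split : ∀ {k} p → Wt.AllW (ℕ._< k) (p ++ p') → Wt.AllW (ℕ._< k) p × Wt.AllW (ℕ._< k) p'
    split []      a       = tt , a
    split (u ∷ p) (x , a) = (x , proj₁ (split p a)) , proj₂ (split p a)

  -- Summing  c h^E d^b m^e x^f y^g  over h, given the sum of  r_E(h)·(that
  -- monomial without h^E) : divide the identity above by E+1.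
  HSum-power : ∀ c E b e f g → HSum (mulP (remainder E) (mono c 0 b e f g ∷ [])) → HSum (mono c E b e f g ∷ [])
  HSum-power c E b e f g (q' , wq' , eq') = q , weight-bound , evaluation
    where
    M' = mono c 0 b e f g ∷ []
    iv = proj₁ (fromℕ-suc-invertible E)
    Dpow = powP varD (suc E)
    q = scaleP iv (mulP Dpow M' ++ scaleP (- 1ℚ) q')

    weightless+ : ∀ {k x y} → x ℕ.≤ 0 → y ℕ.< k → x ℕ.+ y ℕ.< k
    weightless+ {k} {x} {y} x≤0 y<k = subst (λ v → v ℕ.+ y ℕ.< k) (sym (ℕP.n≤0⇒n≡0 x≤0)) y<k

    weight-bound : ∀ k → Wt.AllW (ℕ._< k) (mono c E b e f g ∷ []) → Wt.AllW (ℕ._< k) q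
    weight-bound k (lt , _) = Wt.AllW-scale iv (mulP Dpow M' ++ scaleP (- 1ℚ) q')
      (Wt.AllW-++ (mulP Dpow M') (scaleP (- 1ℚ) q')
        (Wt.AllW-mul weightless+ Dpow M'
          (Wt.AllW-map (λ {x} le → subst (x ℕ.≤_) (ℕP.*-zeroʳ (suc E)) le) Dpow (Wt.AllW-pow 0 varD (suc E) (z≤n , tt)))
          (lt , tt))
        (Wt.AllW-scale (- 1ℚ) q' (wq' k (Wt.AllW-mul weightless+ (remainder E) M' (remainder-weight E) (lt , tt)))))

    evaluation : ∀ hh d m x y → evalP (env hh (fromℕ d) m x y) q
                                ≡ Σ₁ d (λ h → evalP (env (fromℕ h) (fromℕ d) m x y) (mono c E b e f g ∷ []))
    evaluation hh d m x y = begin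
      evalP ρ q
        ≡⟨ trans (evalP-scale ρ iv (mulP Dpow M' ++ scaleP (- 1ℚ) q'))
                 (cong (iv *_) (trans (evalP-++ ρ (mulP Dpow M') (scaleP (- 1ℚ) q')) (cong₂ _+_
             (trans (evalP-mul ρ Dpow M') (cong (_* mv) (trans (evalP-pow ρ varD (suc E)) (cong (_^ suc E) (evalP-varD hh D m x y)))))
             (evalP-scale ρ (- 1ℚ) q')))) ⟩
      iv * (D ^ suc E * mv + - 1ℚ * evalP ρ q')
        ≡⟨ cong (λ z → iv * (D ^ suc E * mv + - 1ℚ * z))
             (trans (eq' hh d m x y) (trans (Σ₁-cong d (λ h → evalP-mul (at h) (remainder E) M')) (Σ₁-*ʳ d mv R))) ⟩
      iv * (D ^ suc E * mv + - 1ℚ * (Σ₁ d R * mv))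
        ≡⟨ cong (iv *_) (solve 3 (λ P S v → P :* v :+ :- con 1ℚ :* (S :* v) := (P :+ :- S) :* v) refl (D ^ suc E) (Σ₁ d R) mv) ⟩
      iv * ((D ^ suc E + - Σ₁ d R) * mv)
        ≡⟨ cong (λ z → iv * (z * mv)) (sym (power-sum-identity d D m x y E)) ⟩
      iv * ((fromℕ (suc E) * Σ₁ d (λ h → fromℕ h ^ E)) * mv)
        ≡⟨ solve 4 (λ i N S v → i :* ((N :* S) :* v) := (N :* i) :* (S :* v)) refl iv (fromℕ (suc E)) (Σ₁ d (λ h → fromℕ h ^ E)) mv ⟩
      (fromℕ (suc E) * iv) * (Σ₁ d (λ h → fromℕ h ^ E) * mv)
        ≡⟨ trans (cong (_* (Σ₁ d (λ h → fromℕ h ^ E) * mv)) (proj₂ (fromℕ-suc-invertible E))) (ℚP.*-identityˡ _) ⟩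
      Σ₁ d (λ h → fromℕ h ^ E) * mv
        ≡⟨ sym (Σ₁-*ʳ d mv (λ h → fromℕ h ^ E)) ⟩
      Σ₁ d (λ h → fromℕ h ^ E * mv)
        ≡⟨ Σ₁-cong d (λ h → solve 3 (λ H c r → H :* (c :* (con 1ℚ :* r) :+ con 0ℚ) := c :* (H :* r) :+ con 0ℚ) refl
                                   (fromℕ h ^ E) c (D ^ b * (m ^ e * (x ^ f * y ^ g)))) ⟩
      Σ₁ d (λ h → evalP (at h) (mono c E b e f g ∷ [])) ∎
      where
      D = fromℕ d
      ρ = env hh D m x y
      at : ℕ → Env
      at h = env (fromℕ h) D m x y
      mv = evalP ρ M'
      R : ℕ → ℚ
      R h = evalP (at h) (remainder E)

  powerSum : ∀ n p → Hd.AllW (ℕ._≤ n) p → HSum p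
  powerSum n []      _         = HSum-[]
  powerSum n (u ∷ p) (hu , hp) = HSum-++ (u ∷ []) p (powerSum-mono n u hu) (powerSum n p hp)
    where
    powerSum-mono : ∀ n u → hdeg u ℕ.≤ n → HSum (u ∷ [])
    powerSum-mono n       (mono c zero b e f g)    _         = HSum-power c 0 b e f g HSum-[]
    powerSum-mono (suc n) (mono c (suc E) b e f g) (s≤s E≤n) = HSum-power c (suc E) b e f g
      (powerSum n (mulP (remainder (suc E)) M')
        (Hd.AllW-mul {Q = _≡ 0} (λ {x} {y} x<E y≡0 → ℕP.≤-trans (ℕP.≤-pred (subst (λ w → x ℕ.+ w ℕ.< suc E) (sym y≡0)
                                                      (subst (ℕ._< suc E) (sym (ℕP.+-identityʳ x)) x<E))) E≤n)
          (remainder (suc E)) M' (remainder-hdeg (suc E)) (refl , tt)))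
      where M' = mono c 0 b e f g ∷ []

  hdegBound : Poly → ℕ
  hdegBound []      = 0
  hdegBound (u ∷ p) = hdeg u ℕ.+ hdegBound p

  hdegBound-ok : ∀ p → Hd.AllW (ℕ._≤ hdegBound p) p
  hdegBound-ok []      = tt
  hdegBound-ok (u ∷ p) = ℕP.m≤m+n (hdeg u) (hdegBound p) ,
    Hd.AllW-map (λ le → ℕP.≤-trans le (ℕP.m≤n+m (hdegBound p) (hdeg u))) p (hdegBound-ok p)

  sumOverH : ∀ p → HSum p
  sumOverH p = powerSum (hdegBound p) p (hdegBound-ok p)

module NiceSubsets where
  -- A column satisfying condition (1) is a "tower" {1, …, h} for some
  -- 0 ≤ h ≤ d, and condition (2) forbids two adjacent non-empty columns.
  -- Prepending a tower of height h to a grid I of length n shifts every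
  -- column index of I by one, so
  --   σ_m(tower ∷ I) = σ_m(tower) + |I| + σ_m(I),   |tower ∷ I| = h + |I| .

  open Rational using (_+_; _*_)
  open NatCast
  open PowerSums using (Σ₁; Σ₁-cong; Σ₁-const; Σ₁-suc)

  ΣL : {A : Set} → List A → (A → ℚ) → ℚ
  ΣL []       f = 0ℚ
  ΣL (x ∷ xs) f = f x + ΣL xs f

  guard : Bool → ℚ → ℚ
  guard b x = if b then x else 0ℚ

  ΣL-cong : {A : Set} (xs : List A) {f g : A → ℚ} → (∀ x → f x ≡ g x) → ΣL xs f ≡ ΣL xs g
  ΣL-cong []       e = refl
  ΣL-cong (x ∷ xs) e = cong₂ _+_ (e x) (ΣL-cong xs e)

  ΣL-++ : {A : Set} (xs ys : List A) (f : A → ℚ) → ΣL (xs ++ ys) f ≡ ΣL xs f + ΣL ys f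
  ΣL-++ []       ys f = sym (ℚP.+-identityˡ (ΣL ys f))
  ΣL-++ (x ∷ xs) ys f = trans (cong (f x +_) (ΣL-++ xs ys f)) (sym (ℚP.+-assoc (f x) (ΣL xs f) (ΣL ys f)))

  ΣL-map : {A B : Set} (g : A → B) (xs : List A) (f : B → ℚ) → ΣL (List.map g xs) f ≡ ΣL xs (λ x → f (g x))
  ΣL-map g []       f = refl
  ΣL-map g (x ∷ xs) f = cong (f (g x) +_) (ΣL-map g xs f)

  ΣL-concatMap : {A B : Set} (g : A → List B) (xs : List A) (f : B → ℚ) →
                 ΣL (concatMap g xs) f ≡ ΣL xs (λ x → ΣL (g x) f)
  ΣL-concatMap g []       f = refl
  ΣL-concatMap g (x ∷ xs) f = trans (ΣL-++ (g x) (concatMap g xs) f) (cong (ΣL (g x) f +_) (ΣL-concatMap g xs f))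

  ΣL-+ : {A : Set} (xs : List A) (f g : A → ℚ) → ΣL xs (λ x → f x + g x) ≡ ΣL xs f + ΣL xs g
  ΣL-+ []       f g = sym (ℚP.+-identityˡ 0ℚ)
  ΣL-+ (x ∷ xs) f g rewrite ΣL-+ xs f g =
    solve 4 (λ a b c e → (a :+ b) :+ (c :+ e) := (a :+ c) :+ (b :+ e)) refl (f x) (g x) (ΣL xs f) (ΣL xs g)

  ΣL-* : {A : Set} (xs : List A) (c : ℚ) (f : A → ℚ) → ΣL xs (λ x → c * f x) ≡ c * ΣL xs f
  ΣL-* []       c f = sym (ℚP.*-zeroʳ c)
  ΣL-* (x ∷ xs) c f rewrite ΣL-* xs c f = sym (ℚP.*-distribˡ-+ c (f x) (ΣL xs f))

  ΣL-0 : {A : Set} (xs : List A) → ΣL xs (λ _ → 0ℚ) ≡ 0ℚ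
  ΣL-0 []       = refl
  ΣL-0 (x ∷ xs) rewrite ΣL-0 xs = refl

  ΣL-Σ₁ : {A : Set} (xs : List A) (d : ℕ) (f : A → ℕ → ℚ) →
          ΣL xs (λ x → Σ₁ d (f x)) ≡ Σ₁ d (λ h → ΣL xs (λ x → f x h))
  ΣL-Σ₁ xs zero    f = ΣL-0 xs
  ΣL-Σ₁ xs (suc d) f = trans (ΣL-+ xs (λ x → Σ₁ d (f x)) (λ x → f x (suc d)))
                             (cong (_+ ΣL xs (λ x → f x (suc d))) (ΣL-Σ₁ xs d f))

  guard-0 : ∀ b → guard b 0ℚ ≡ 0ℚ
  guard-0 true  = refl
  guard-0 false = refl

  guard-∧ : ∀ a b x → guard (a ∧ b) x ≡ guard a (guard b x)
  guard-∧ true  b x = refl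
  guard-∧ false b x = refl

  ΣL-guard : {A : Set} (xs : List A) (b : Bool) (f : A → ℚ) → ΣL xs (λ x → guard b (f x)) ≡ guard b (ΣL xs f)
  ΣL-guard xs true  f = refl
  ΣL-guard xs false f = ΣL-0 xs

  guard-+ : ∀ b x y → guard b (x + y) ≡ guard b x + guard b y
  guard-+ true  x y = refl
  guard-+ false x y = sym (ℚP.+-identityˡ 0ℚ)

  guard-* : ∀ b c x → guard b (c * x) ≡ c * guard b x
  guard-* true  c x = refl
  guard-* false c x = sym (ℚP.*-zeroʳ c)

  guard-Σ₁ : ∀ b d f → guard b (Σ₁ d f) ≡ Σ₁ d (λ h → guard b (f h))
  guard-Σ₁ true  d f = refl
  guard-Σ₁ false d f = sym (trans (Σ₁-const d 0ℚ) (ℚP.*-zeroʳ (fromℕ d)))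

  colSize : {k : ℕ} → Vec Bool k → ℕ
  colSize []      = 0
  colSize (x ∷ c) = (if x then 1 else 0) ℕ.+ colSize c

  colWeight : ℕ → ℕ → {k : ℕ} → Vec Bool k → ℕ
  colWeight m j []      = 0
  colWeight m j (x ∷ c) = (if x then j else 0) ℕ.+ colWeight m (m ℕ.+ j) c

  colWeight-shift : ∀ m k j {l} (c : Vec Bool l) → colWeight m (k ℕ.+ j) c ≡ k ℕ.* colSize c ℕ.+ colWeight m j c
  colWeight-shift m k j []      = sym (cong (ℕ._+ 0) (ℕP.*-zeroʳ k))
  colWeight-shift m k j (x ∷ c)
    rewrite sym (ℕP.+-assoc m k j) | ℕP.+-comm m k | ℕP.+-assoc k m j | colWeight-shift m k (m ℕ.+ j) c with x
  ... | true  = regroup k j (colSize c) (colWeight m (m ℕ.+ j) c)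
    where
    regroup : ∀ k j C S → k ℕ.+ j ℕ.+ (k ℕ.* C ℕ.+ S) ≡ k ℕ.* (1 ℕ.+ C) ℕ.+ (j ℕ.+ S)
    regroup = solve-∀
  ... | false = regroup k (colSize c) (colWeight m (m ℕ.+ j) c)
    where
    regroup : ∀ k C S → 0 ℕ.+ (k ℕ.* C ℕ.+ S) ≡ k ℕ.* (0 ℕ.+ C) ℕ.+ (0 ℕ.+ S)
    regroup = solve-∀

  gridSize : ∀ {d n} → Grid d n → ℕ
  gridSize []      = 0
  gridSize (c ∷ I) = colSize c ℕ.+ gridSize I

  -- gridWeight m j I is σ_m(I) when the first column of I has index j.
  gridWeight : ∀ {d n} → ℕ → ℕ → Grid d n → ℕ
  gridWeight m j []      = 0
  gridWeight m j (c ∷ I) = colWeight m j c ℕ.+ gridWeight m (suc j) I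

  gridWeight-suc : ∀ {d n} m j (I : Grid d n) → gridWeight m (suc j) I ≡ gridSize I ℕ.+ gridWeight m j I
  gridWeight-suc m j []      = refl
  gridWeight-suc m j (c ∷ I)
    rewrite colWeight-shift m 1 j c | gridWeight-suc m (suc j) I | ℕP.*-identityˡ (colSize c) =
    regroup (colSize c) (colWeight m j c) (gridSize I) (gridWeight m (suc j) I)
    where
    regroup : ∀ a b c' e → a ℕ.+ b ℕ.+ (c' ℕ.+ e) ≡ a ℕ.+ c' ℕ.+ (b ℕ.+ e)
    regroup = solve-∀

  sumℕ-allFin : ∀ {n} (f : Fin n → ℕ) → sumℕ (List.map f (allFin n)) ≡ sumℕ (tabulate f)
  sumℕ-allFin f = cong sumℕ (ListP.map-tabulate (λ x → x) f)

  card≡gridSize : ∀ {d n} (I : Grid d n) → card I ≡ gridSize I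
  card≡gridSize {d} I =
    trans (sumℕ-allFin (λ j → sumℕ (List.map (λ i → if lookup (lookup I j) i then 1 else 0) (allFin d)))) (columns I)
    where
    column : ∀ {k} (c : Vec Bool k) → sumℕ (tabulate (λ i → if lookup c i then 1 else 0)) ≡ colSize c
    column []      = refl
    column (x ∷ c) = cong ((if x then 1 else 0) ℕ.+_) (column c)
    columns : ∀ {n} (I : Grid d n) →
      sumℕ (tabulate (λ j → sumℕ (List.map (λ i → if lookup (lookup I j) i then 1 else 0) (allFin d)))) ≡ gridSize I
    columns []      = refl
    columns (c ∷ I) = cong₂ ℕ._+_ (trans (sumℕ-allFin (λ i → if lookup c i then 1 else 0)) (column c)) (columns I)

  sigma≡gridWeight : ∀ {d n} m (I : Grid d n) → sigma m I ≡ gridWeight m 1 I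
  sigma≡gridWeight {d} m I = trans (sumℕ-allFin (λ j → sumℕ (List.map (cell j) (allFin d))))
    (trans (cong sumℕ (ListP.tabulate-cong (λ j → trans (sumℕ-allFin (cell j))
             (trans (column (lookup I j) (suc (toℕ j))) (cong (λ z → colWeight m z (lookup I j)) (ℕP.+-comm 1 (toℕ j)))))))
      (columns I 1))
    where
    cell : Fin _ → Fin d → ℕ
    cell j i = if lookup (lookup I j) i then toℕ i ℕ.* m ℕ.+ suc (toℕ j) else 0
    column : ∀ {k} (c : Vec Bool k) J → sumℕ (tabulate (λ i → if lookup c i then toℕ i ℕ.* m ℕ.+ J else 0)) ≡ colWeight m J c
    column []      J = refl
    column (x ∷ c) J = cong ((if x then J else 0) ℕ.+_)
      (trans (cong sumℕ (ListP.tabulate-cong (λ i → next-row (lookup c i) (toℕ i)))) (column c (m ℕ.+ J)))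
      where
      next-row : ∀ b t → (if b then suc t ℕ.* m ℕ.+ J else 0) ≡ (if b then t ℕ.* m ℕ.+ (m ℕ.+ J) else 0)
      next-row true  t = regroup m t J
        where
        regroup : ∀ m t J → m ℕ.+ t ℕ.* m ℕ.+ J ≡ t ℕ.* m ℕ.+ (m ℕ.+ J)
        regroup = solve-∀
      next-row false t = refl
    columns : ∀ {n} (I : Grid d n) J → sumℕ (tabulate (λ j → colWeight m (toℕ j ℕ.+ J) (lookup I j))) ≡ gridWeight m J I
    columns []      J = refl
    columns (c ∷ I) J = cong (colWeight m J c ℕ.+_)
      (trans (cong sumℕ (ListP.tabulate-cong (λ j → cong (λ z → colWeight m z (lookup I j)) (sym (ℕP.+-suc (toℕ j) J)))))
             (columns I (suc J)))

  bits : List Bool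
  bits = true ∷ false ∷ []

  colOK-true : ∀ {k} (c : Vec Bool k) → colOK (true ∷ c) ≡ colOK c
  colOK-true []          = refl
  colOK-true (true ∷ c)  = refl
  colOK-true (false ∷ c) = refl

  emptyCol : ∀ k → Vec Bool k
  emptyCol k = replicate k false

  colWeight-empty : ∀ m j k → colWeight m j (emptyCol k) ≡ 0
  colWeight-empty m j zero    = refl
  colWeight-empty m j (suc k) = colWeight-empty m (m ℕ.+ j) k

  colSize-empty : ∀ k → colSize (emptyCol k) ≡ 0
  colSize-empty zero    = refl
  colSize-empty (suc k) = colSize-empty k

  sum-below-empty : ∀ d (G : Vec Bool d → ℚ) → ΣL (allVecs d bits) (λ c → guard (colOK (false ∷ c)) (G c)) ≡ G (emptyCol d)
  sum-below-empty zero    G = ℚP.+-identityʳ (G [])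
  sum-below-empty (suc d) G = begin
    ΣL (List.map (true ∷_) V ++ (List.map (false ∷_) V ++ [])) f
      ≡⟨ trans (ΣL-++ (List.map (true ∷_) V) _ f)
           (cong₂ _+_ (trans (ΣL-map (true ∷_) V f) (ΣL-0 V))
                      (trans (ΣL-++ (List.map (false ∷_) V) [] f) (trans (ℚP.+-identityʳ _) (ΣL-map (false ∷_) V f)))) ⟩
    0ℚ + ΣL V (λ c → guard (colOK (false ∷ c)) (G (false ∷ c)))
      ≡⟨ trans (ℚP.+-identityˡ _) (sum-below-empty d (λ c → G (false ∷ c))) ⟩
    G (emptyCol (suc d)) ∎
    where
    V = allVecs d bits
    f = λ c → guard (colOK (false ∷ c)) (G c)

  -- σ_m of the tower of height h placed in column 1:  Σ_{i=1}^h ((i-1) m + 1).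
  towerWeight : ℕ → ℕ → ℕ
  towerWeight m zero    = 0
  towerWeight m (suc h) = 1 ℕ.+ (m ℕ.* h ℕ.+ towerWeight m h)

  sum-over-columns : ∀ m d (F : Bool → ℕ → ℕ → ℚ) →
    ΣL (allVecs d bits) (λ c → guard (colOK c) (F (row1 c) (colWeight m 1 c) (colSize c)))
      ≡ F false 0 0 + Σ₁ d (λ h → F true (towerWeight m h) h)
  sum-over-columns m zero    F = refl
  sum-over-columns m (suc d) F = begin
    ΣL (List.map (true ∷_) V ++ (List.map (false ∷_) V ++ [])) f
      ≡⟨ trans (ΣL-++ (List.map (true ∷_) V) _ f)
           (cong₂ _+_ (ΣL-map (true ∷_) V f)
                      (trans (ΣL-++ (List.map (false ∷_) V) [] f) (trans (ℚP.+-identityʳ _) (ΣL-map (false ∷_) V f)))) ⟩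
    ΣL V (λ c → f (true ∷ c)) + ΣL V (λ c → f (false ∷ c))
      ≡⟨ cong₂ _+_ (trans (ΣL-cong V top-cell) (sum-over-columns m d F'))
                   (trans (sum-below-empty d (λ c → F false (colWeight m (m ℕ.+ 1) c) (colSize c)))
                          (cong₂ (F false) (colWeight-empty m (m ℕ.+ 1) d) (colSize-empty d))) ⟩
    (F' false 0 0 + Σ₁ d (λ h → F' true (towerWeight m h) h)) + F false 0 0
      ≡⟨ cong (λ z → (F true (1 ℕ.+ (z ℕ.+ 0)) 1 + Σ₁ d (λ h → F' true (towerWeight m h) h)) + F false 0 0) (ℕP.*-zeroʳ m) ⟩
    (F true 1 1 + Σ₁ d (λ h → F true (towerWeight m (suc h)) (suc h))) + F false 0 0
      ≡⟨ ℚP.+-comm _ (F false 0 0) ⟩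
    F false 0 0 + (F true 1 1 + Σ₁ d (λ h → F true (towerWeight m (suc h)) (suc h)))
      ≡⟨ cong (F false 0 0 +_) (sym (trans (Σ₁-suc d (λ h → F true (towerWeight m h) h))
           (cong (λ z → F true (1 ℕ.+ (z ℕ.+ 0)) 1 + Σ₁ d (λ h → F true (towerWeight m (suc h)) (suc h))) (ℕP.*-zeroʳ m)))) ⟩
    F false 0 0 + Σ₁ (suc d) (λ h → F true (towerWeight m h) h) ∎
    where
    V = allVecs d bits
    f = λ c → guard (colOK c) (F (row1 c) (colWeight m 1 c) (colSize c))
    -- a column with a top cell: one more cell, and the rest moved down a row
    F' : Bool → ℕ → ℕ → ℚ
    F' b s k = F true (1 ℕ.+ (m ℕ.* k ℕ.+ s)) (1 ℕ.+ k)
    top-cell : ∀ c → f (true ∷ c) ≡ guard (colOK c) (F' (row1 c) (colWeight m 1 c) (colSize c))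
    top-cell c rewrite colOK-true c | colWeight-shift m m 1 c = refl

  firstCell : ∀ {d n} → Grid d n → Bool
  firstCell []      = false
  firstCell (c ∷ _) = row1 c

  ∧-regroup : ∀ a b x y → (a ∧ b) ∧ (x ∧ y) ≡ a ∧ ((b ∧ y) ∧ x)
  ∧-regroup true  true  true  true  = refl
  ∧-regroup true  true  true  false = refl
  ∧-regroup true  true  false true  = refl
  ∧-regroup true  true  false false = refl
  ∧-regroup true  false x     y     = refl
  ∧-regroup false b     x     y     = refl

  isNice-∷ : ∀ {d n} (c : Vec Bool d) (I : Grid d n) →
             isNice (c ∷ I) ≡ colOK c ∧ (isNice I ∧ (row1 c ⇒ᵇ not (firstCell I)))
  isNice-∷ c [] with colOK c | row1 c
  ... | true  | true  = refl
  ... | true  | false = refl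
  ... | false | _     = refl
  isNice-∷ c (c' ∷ I) = ∧-regroup (colOK c) (allCols (c' ∷ I)) (row1 c ⇒ᵇ not (row1 c')) (adjOK (c' ∷ I))

  niceSum : ℕ → ℕ → ℕ → (ℕ → ℕ → ℚ) → ℚ
  niceSum d m n w = ΣL (allGrids d n) (λ I → guard (isNice I) (w (gridWeight m 1 I) (gridSize I)))

  niceSum° : ℕ → ℕ → ℕ → (ℕ → ℕ → ℚ) → ℚ
  niceSum° d m n w = ΣL (allGrids d n) (λ I → guard (isNice I) (guard (not (firstCell I)) (w (gridWeight m 1 I) (gridSize I))))

  niceSum-0 : ∀ d m w → niceSum d m 0 w ≡ w 0 0
  niceSum-0 d m w = ℚP.+-identityʳ (w 0 0)

  niceSum°-0 : ∀ d m w → niceSum° d m 0 w ≡ w 0 0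
  niceSum°-0 d m w = ℚP.+-identityʳ (w 0 0)

  sum-over-first-column : ∀ d m n (body : ∀ {k} → Grid d k → ℚ) (F : Bool → ℕ → ℕ → ℚ) →
    (∀ c → ΣL (allGrids d n) (λ I → body (c ∷ I)) ≡ guard (colOK c) (F (row1 c) (colWeight m 1 c) (colSize c))) →
    ΣL (allGrids d (suc n)) body ≡ F false 0 0 + Σ₁ d (λ h → F true (towerWeight m h) h)
  sum-over-first-column d m n body F e = begin
    ΣL (concatMap (λ c → List.map (c ∷_) (allGrids d n)) (allVecs d bits)) body
      ≡⟨ ΣL-concatMap (λ c → List.map (c ∷_) (allGrids d n)) (allVecs d bits) body ⟩
    ΣL (allVecs d bits) (λ c → ΣL (List.map (c ∷_) (allGrids d n)) body)
      ≡⟨ ΣL-cong (allVecs d bits) (λ c → trans (ΣL-map (c ∷_) (allGrids d n) body) (e c)) ⟩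
    ΣL (allVecs d bits) (λ c → guard (colOK c) (F (row1 c) (colWeight m 1 c) (colSize c)))
      ≡⟨ sum-over-columns m d F ⟩
    F false 0 0 + Σ₁ d (λ h → F true (towerWeight m h) h) ∎

  nice-summand-∷ : ∀ {d n} m (w : ℕ → ℕ → ℚ) (e : Bool → Bool) (c : Vec Bool d) (I : Grid d n) →
    guard (isNice (c ∷ I)) (guard (e (row1 c)) (w (gridWeight m 1 (c ∷ I)) (gridSize (c ∷ I))))
      ≡ guard (colOK c) (guard (isNice I) (guard (row1 c ⇒ᵇ not (firstCell I))
          (guard (e (row1 c)) (w (colWeight m 1 c ℕ.+ (gridSize I ℕ.+ gridWeight m 1 I)) (colSize c ℕ.+ gridSize I)))))
  nice-summand-∷ m w e c I =
    trans (cong₂ (λ b z → guard b (guard (e (row1 c)) (w (colWeight m 1 c ℕ.+ z) (colSize c ℕ.+ gridSize I))))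
                 (isNice-∷ c I) (gridWeight-suc m 1 I))
          (trans (guard-∧ (colOK c) _ _) (cong (guard (colOK c)) (guard-∧ (isNice I) _ _)))

  niceSum-suc : ∀ d m n w → niceSum d m (suc n) w
    ≡ niceSum d m n (λ s k → w (k ℕ.+ s) k) + Σ₁ d (λ h → niceSum° d m n (λ s k → w (towerWeight m h ℕ.+ (k ℕ.+ s)) (h ℕ.+ k)))
  niceSum-suc d m n w = sum-over-first-column d m n (λ I → guard (isNice I) (w (gridWeight m 1 I) (gridSize I))) F
    (λ c → trans (ΣL-cong (allGrids d n) (nice-summand-∷ m w (λ _ → true) c)) (ΣL-guard (allGrids d n) (colOK c) _))
    where
    F : Bool → ℕ → ℕ → ℚ
    F b s k = ΣL (allGrids d n) (λ I → guard (isNice I) (guard (b ⇒ᵇ not (firstCell I))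
                (w (s ℕ.+ (gridSize I ℕ.+ gridWeight m 1 I)) (k ℕ.+ gridSize I))))

  niceSum°-suc : ∀ d m n w → niceSum° d m (suc n) w ≡ niceSum d m n (λ s k → w (k ℕ.+ s) k)
  niceSum°-suc d m n w = begin
    niceSum° d m (suc n) w
      ≡⟨ sum-over-first-column d m n (λ I → guard (isNice I) (guard (not (firstCell I)) (w (gridWeight m 1 I) (gridSize I)))) F
           (λ c → trans (ΣL-cong (allGrids d n) (nice-summand-∷ m w not c)) (ΣL-guard (allGrids d n) (colOK c) _)) ⟩
    F false 0 0 + Σ₁ d (λ h → F true (towerWeight m h) h)
      ≡⟨ cong (F false 0 0 +_) (trans (Σ₁-cong d (λ h → ΣL-cong (allGrids d n)
                                         (λ I → trans (cong (guard (isNice I)) (guard-0 _)) (guard-0 (isNice I)))))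
                                 (trans (Σ₁-cong d (λ h → ΣL-0 (allGrids d n)))
                                        (trans (Σ₁-const d 0ℚ) (ℚP.*-zeroʳ (fromℕ d))))) ⟩
    F false 0 0 + 0ℚ
      ≡⟨ ℚP.+-identityʳ _ ⟩
    niceSum d m n (λ s k → w (k ℕ.+ s) k) ∎
    where
    F : Bool → ℕ → ℕ → ℚ
    F b s k = ΣL (allGrids d n) (λ I → guard (isNice I) (guard (b ⇒ᵇ not (firstCell I))
                (guard (not b) (w (s ℕ.+ (gridSize I ℕ.+ gridWeight m 1 I)) (k ℕ.+ gridSize I)))))

  fromℕ-sum : {A : Set} (g : A → ℕ) (xs : List A) → fromℕ (sumℕ (List.map g xs)) ≡ ΣL xs (λ x → fromℕ (g x))
  fromℕ-sum g []       = refl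
  fromℕ-sum g (x ∷ xs) = trans (fromℕ-+ (g x) _) (cong (fromℕ (g x) +_) (fromℕ-sum g xs))

  fromℕ-if : ∀ b X → fromℕ (if b then X else 0) ≡ guard b (fromℕ X)
  fromℕ-if true  X = refl
  fromℕ-if false X = refl

  Gplus≡niceSum : ∀ d m a b n → fromℕ (Gplus d m a b n) ≡ niceSum d m n (λ s k → fromℕ s ^ a * fromℕ k ^ b)
  Gplus≡niceSum d m a b n = trans (fromℕ-sum _ (allGrids d n))
    (ΣL-cong (allGrids d n) (λ I → trans (fromℕ-if (isNice I) _)
      (cong (guard (isNice I)) (trans (fromℕ-* (sigma m I ℕ.^ a) (card I ℕ.^ b))
        (cong₂ _*_ (trans (fromℕ-^ (sigma m I) a) (cong (λ z → fromℕ z ^ a) (sigma≡gridWeight m I)))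
                   (trans (fromℕ-^ (card I) b) (cong (λ z → fromℕ z ^ b) (card≡gridSize I))))))))

module Moments where

  open Rational using (_+_; _*_)
  open NatCast
  open PartialFractions
  open Polynomials
  open PowerSums
  open NiceSubsets

  niceSum-cong : ∀ d m n {w w'} → (∀ s k → w s k ≡ w' s k) → niceSum d m n w ≡ niceSum d m n w'
  niceSum-cong d m n e = ΣL-cong (allGrids d n) (λ I → cong (guard (isNice I)) (e (gridWeight m 1 I) (gridSize I)))

  niceSum-+ : ∀ d m n w w' → niceSum d m n (λ s k → w s k + w' s k) ≡ niceSum d m n w + niceSum d m n w'
  niceSum-+ d m n w w' = trans (ΣL-cong (allGrids d n) (λ I → guard-+ (isNice I) _ _)) (ΣL-+ (allGrids d n) _ _)

  niceSum-* : ∀ d m n c w → niceSum d m n (λ s k → c * w s k) ≡ c * niceSum d m n w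
  niceSum-* d m n c w = trans (ΣL-cong (allGrids d n) (λ I → guard-* (isNice I) c _)) (ΣL-* (allGrids d n) c _)

  niceSum-zero : ∀ d m n → niceSum d m n (λ _ _ → 0ℚ) ≡ 0ℚ
  niceSum-zero d m n = trans (ΣL-cong (allGrids d n) (λ I → guard-0 (isNice I))) (ΣL-0 (allGrids d n))

  niceSum-Σ₁ : ∀ d m n e (f : ℕ → ℕ → ℕ → ℚ) →
               niceSum d m n (λ s k → Σ₁ e (f s k)) ≡ Σ₁ e (λ h → niceSum d m n (λ s k → f s k h))
  niceSum-Σ₁ d m n e f = trans (ΣL-cong (allGrids d n) (λ I → guard-Σ₁ (isNice I) e _)) (ΣL-Σ₁ (allGrids d n) e _)

  power : ℕ → ℕ → ℕ → ℕ → ℚ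
  power α β s k = fromℕ s ^ α * fromℕ k ^ β

  moment : ℕ → ℕ → ℕ → ℕ → Series
  moment α β d m n = niceSum d m n (power α β)

  momentWeight : ℕ → ℕ → ℕ
  momentWeight α β = α ℕ.+ (α ℕ.+ β)

  at0 : ℕ → ℕ → ℕ → ℕ → Env
  at0 d m s k = env 0ℚ (fromℕ d) (fromℕ m) (fromℕ s) (fromℕ k)

  polyMoment : Poly → ℕ → ℕ → Series
  polyMoment e d m n = niceSum d m n (λ s k → evalP (at0 d m s k) e)

  LowerMoments : ℕ → Set
  LowerMoments K = ∀ α β → momentWeight α β ℕ.< K → PartialFractions (suc (momentWeight α β)) (moment α β)

  polyMoment-PF : ∀ K → LowerMoments K → ∀ e → Wt.AllW (ℕ._< K) e → PartialFractions K (polyMoment e)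
  polyMoment-PF K lower []                        _        =
    PF-resp (λ d m n → sym (niceSum-zero d m n)) (PF-zero K)
  polyMoment-PF K lower (mono c a b em f g ∷ e) (lt , es) =
    PF-resp (λ d m n → sym (trans (niceSum-+ d m n (λ s k → evalM (at0 d m s k) (mono c a b em f g)) (λ s k → evalP (at0 d m s k) e))
                                  (cong (_+ polyMoment e d m n)
                                    (trans (niceSum-cong d m n (monomial-as-moment d m))
                                           (niceSum-* d m n (evalParam coeff d m) (power f g))))))
      (PF-add (PF-weaken rank≤K (PF-scale coeff (lower f g (ℕP.≤-<-trans (ℕP.m≤n+m (momentWeight f g) em) lt))))
              (polyMoment-PF K lower e es))
    where
    coeff : ParamMono
    coeff = (c * 0ℚ ^ a , b , em)
    rank≤K : suc (momentWeight f g) ℕ.+ em ℕ.≤ K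
    rank≤K = subst (ℕ._≤ K) (cong suc (ℕP.+-comm em (momentWeight f g))) lt
    monomial-as-moment : ∀ d m s k → evalM (at0 d m s k) (mono c a b em f g) ≡ evalParam coeff d m * power f g s k
    monomial-as-moment d m s k =
      trans (solve 5 (λ c z D M W → c :* (z :* (D :* (M :* W))) := (c :* z :* (D :* M)) :* W) refl
               c (0ℚ ^ a) (fromℕ d ^ b) (fromℕ m ^ em) (power f g s k))
            (cong (λ z → (c * 0ℚ ^ a * z) * power f g s k)
                  (sym (trans (fromℕ-* (d ℕ.^ b) (m ℕ.^ em)) (cong₂ _*_ (fromℕ-^ d b) (fromℕ-^ m em)))))

module ColumnExpansions where
  -- The two weights occurring in the transfer recurrence, as polynomials:
  --   shifting:   (σ + |I|)^α |I|^β                             (x + y)^α y^β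
  --   prepending: (tower(h) + 2|I| + σ)^α (h + |I|)^β   (x + tower + 2y)^α (y + h)^β
  -- (prepending a tower to a grid J with first column empty and J' = J minus
  -- that column gives  σ = tower(h) + |J'| + |J'| + σ(J')).  Both equal the
  -- leading monomial  x^α y^β  plus terms of smaller weight, because the
  -- tower weight  h + m·h(h-1)/2  has weight ≤ 1 < 2 = weight of x.

  open Rational using (_+_; _*_; -_)
  open NatCast
  open Polynomials
  open PowerSums
  open NiceSubsets
  open Moments

  towerPoly : Poly
  towerPoly = varH ++ (scaleP ½ (mulP varM (mulP varH varH)) ++ scaleP (- ½) (mulP varM varH))

  towerPoly-eval : ∀ h d m x y → evalP (env h d m x y) towerPoly ≡ h + (½ * (m * (h * h)) + - ½ * (m * h))
  towerPoly-eval h d m x y =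
    trans (evalP-++ ρ varH (scaleP ½ (mulP varM (mulP varH varH)) ++ scaleP (- ½) (mulP varM varH)))
      (cong₂ _+_ (evalP-varH h d m x y)
        (trans (evalP-++ ρ (scaleP ½ (mulP varM (mulP varH varH))) (scaleP (- ½) (mulP varM varH)))
          (cong₂ _+_
            (trans (evalP-scale ρ ½ (mulP varM (mulP varH varH)))
              (cong (½ *_) (trans (evalP-mul ρ varM (mulP varH varH))
                (cong₂ _*_ (evalP-varM h d m x y) (trans (evalP-mul ρ varH varH) (cong₂ _*_ (evalP-varH h d m x y) (evalP-varH h d m x y)))))))
            (trans (evalP-scale ρ (- ½) (mulP varM varH))
              (cong (- ½ *_) (trans (evalP-mul ρ varM varH) (cong₂ _*_ (evalP-varM h d m x y) (evalP-varH h d m x y))))))))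
    where ρ = env h d m x y

  towerWeight-eval : ∀ m h → fromℕ (towerWeight m h)
    ≡ fromℕ h + (½ * (fromℕ m * (fromℕ h * fromℕ h)) + - ½ * (fromℕ m * fromℕ h))
  towerWeight-eval m zero    =
    solve 1 (λ M → con 0ℚ := con 0ℚ :+ (con ½ :* (M :* (con 0ℚ :* con 0ℚ)) :+ :- con ½ :* (M :* con 0ℚ))) refl (fromℕ m)
  towerWeight-eval m (suc h) = begin
    fromℕ (1 ℕ.+ (m ℕ.* h ℕ.+ towerWeight m h))
      ≡⟨ trans (fromℕ-+ 1 (m ℕ.* h ℕ.+ towerWeight m h))
               (cong (1ℚ +_) (trans (fromℕ-+ (m ℕ.* h) (towerWeight m h)) (cong₂ _+_ (fromℕ-* m h) (towerWeight-eval m h)))) ⟩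
    1ℚ + (M * H + (H + (½ * (M * (H * H)) + - ½ * (M * H))))
      ≡⟨ solve 2 (λ M H → con 1ℚ :+ (M :* H :+ (H :+ (con ½ :* (M :* (H :* H)) :+ :- con ½ :* (M :* H)))) :=
                          (con 1ℚ :+ H) :+ (con ½ :* (M :* ((con 1ℚ :+ H) :* (con 1ℚ :+ H))) :+ :- con ½ :* (M :* (con 1ℚ :+ H)))) refl M H ⟩
    (1ℚ + H) + (½ * (M * ((1ℚ + H) * (1ℚ + H))) + - ½ * (M * (1ℚ + H)))
      ≡⟨ cong (λ z → z + (½ * (M * (z * z)) + - ½ * (M * z))) (sym (fromℕ-+ 1 h)) ⟩
    fromℕ (suc h) + (½ * (M * (fromℕ (suc h) * fromℕ (suc h))) + - ½ * (M * fromℕ (suc h))) ∎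
    where
    M = fromℕ m
    H = fromℕ h

  newColumn : Poly
  newColumn = towerPoly ++ scaleP (1ℚ + 1ℚ) varY

  varX≤2 : Wt.AllW (ℕ._≤ 2) varX
  varX≤2 = ℕP.≤-refl , tt

  varY≤1 : Wt.AllW (ℕ._≤ 1) varY
  varY≤1 = ℕP.≤-refl , tt

  varY<2 : Wt.AllW (ℕ._< 2) varY
  varY<2 = ℕP.≤-refl , tt

  varH<1 : Wt.AllW (ℕ._< 1) varH
  varH<1 = s≤s z≤n , tt

  newColumn<2 : Wt.AllW (ℕ._< 2) newColumn
  newColumn<2 = s≤s z≤n , s≤s (s≤s z≤n) , s≤s (s≤s z≤n) , s≤s (s≤s z≤n) , tt

  momentWeight≡ : ∀ α β → α ℕ.* 2 ℕ.+ β ℕ.* 1 ≡ α ℕ.+ (α ℕ.+ β)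
  momentWeight≡ = solve-∀

  module Expansions (α β : ℕ) where

    W = momentWeight α β

    leading shifted prepended : Poly
    leading   = mulP (powP varX α) (powP varY β)
    shifted   = mulP (powP (varX ++ varY) α) (powP varY β)
    prepended = mulP (powP (varX ++ newColumn) α) (powP (varY ++ varH) β)

    LeadingTerm : Poly → Set
    LeadingTerm p = Σ Poly λ R → Wt.AllW (ℕ._< W) R × (∀ ρ → evalP ρ p ≡ evalP ρ leading + evalP ρ R)

    shifted-leading : LeadingTerm shifted
    shifted-leading = mulP R (powP varY β) ,
      subst (λ z → Wt.AllW (ℕ._< z) (mulP R (powP varY β))) (momentWeight≡ α β)
        (Wt.AllW-mul Wt.<+≤ R (powP varY β) R< (Wt.AllW-pow 1 varY β varY≤1)) ,
      λ ρ → begin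
        evalP ρ shifted
          ≡⟨ evalP-mul ρ (powP (varX ++ varY) α) (powP varY β) ⟩
        evalP ρ (powP (varX ++ varY) α) * evalP ρ (powP varY β)
          ≡⟨ cong (_* evalP ρ (powP varY β)) (split ρ) ⟩
        (evalP ρ (powP varX α) + evalP ρ R) * evalP ρ (powP varY β)
          ≡⟨ ℚP.*-distribʳ-+ (evalP ρ (powP varY β)) (evalP ρ (powP varX α)) (evalP ρ R) ⟩
        evalP ρ (powP varX α) * evalP ρ (powP varY β) + evalP ρ R * evalP ρ (powP varY β)
          ≡⟨ sym (cong₂ _+_ (evalP-mul ρ (powP varX α) (powP varY β)) (evalP-mul ρ R (powP varY β))) ⟩
        evalP ρ leading + evalP ρ (mulP R (powP varY β)) ∎
      where
      xPart = Wt.pow-leading 2 α varX varY varX≤2 varY<2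
      R = proj₁ xPart
      R< = proj₁ (proj₂ xPart)
      split = proj₂ (proj₂ xPart)

    prepended-leading : LeadingTerm prepended
    prepended-leading = proj₁ product ,
      subst (λ z → Wt.AllW (ℕ._< z) (proj₁ product)) (momentWeight≡ α β) (proj₁ (proj₂ product)) ,
      λ ρ → trans (evalP-mul ρ (powP (varX ++ newColumn) α) (powP (varY ++ varH) β))
        (trans (cong₂ _*_ (trans (proj₂ (proj₂ xPart) ρ) (sym (evalP-++ ρ (powP varX α) (proj₁ xPart))))
                          (trans (proj₂ (proj₂ yPart) ρ) (sym (evalP-++ ρ (powP varY β) (proj₁ yPart)))))
               (proj₂ (proj₂ product) ρ))
      where
      xPart = Wt.pow-leading 2 α varX newColumn varX≤2 newColumn<2
      yPart = Wt.pow-leading 1 β varY varH varY≤1 varH<1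
      product = Wt.mul-leading (α ℕ.* 2) (β ℕ.* 1) (powP varX α) (proj₁ xPart) (powP varY β) (proj₁ yPart)
                  (Wt.AllW-pow 2 varX α varX≤2) (proj₁ (proj₂ xPart)) (Wt.AllW-pow 1 varY β varY≤1) (proj₁ (proj₂ yPart))

    prepended-weight : Wt.AllW (ℕ._< suc W) prepended
    prepended-weight = subst (λ z → Wt.AllW (ℕ._< suc z) prepended) (momentWeight≡ α β)
      (Wt.AllW-map {ℕ._≤ α ℕ.* 2 ℕ.+ β ℕ.* 1} s≤s prepended
        (Wt.AllW-mul {ℕ._≤ α ℕ.* 2} {ℕ._≤ β ℕ.* 1} ℕP.+-mono-≤ (powP (varX ++ newColumn) α) (powP (varY ++ varH) β)
          (Wt.AllW-pow 2 (varX ++ newColumn) α (Wt.AllW-++ {ℕ._≤ 2} varX newColumn varX≤2 (Wt.AllW-map {ℕ._< 2} ℕP.<⇒≤ newColumn newColumn<2)))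
          (Wt.AllW-pow 1 (varY ++ varH) β (Wt.AllW-++ {ℕ._≤ 1} varY varH varY≤1 (Wt.AllW-map {ℕ._< 1} ℕP.<⇒≤ varH varH<1)))))

    leading-eval : ∀ hh d m s k → evalP (env hh (fromℕ d) (fromℕ m) (fromℕ s) (fromℕ k)) leading ≡ power α β s k
    leading-eval hh d m s k = trans (evalP-mul ρ (powP varX α) (powP varY β))
      (cong₂ _*_ (trans (evalP-pow ρ varX α) (cong (_^ α) (evalP-varX hh (fromℕ d) (fromℕ m) (fromℕ s) (fromℕ k))))
                 (trans (evalP-pow ρ varY β) (cong (_^ β) (evalP-varY hh (fromℕ d) (fromℕ m) (fromℕ s) (fromℕ k)))))
      where ρ = env hh (fromℕ d) (fromℕ m) (fromℕ s) (fromℕ k)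

    shifted-eval : ∀ d m s k → evalP (at0 d m s k) shifted ≡ power α β (k ℕ.+ s) k
    shifted-eval d m s k = trans (evalP-mul ρ (powP (varX ++ varY) α) (powP varY β))
      (cong₂ _*_ (trans (evalP-pow ρ (varX ++ varY) α) (cong (_^ α) (begin
                    evalP ρ (varX ++ varY)
                      ≡⟨ evalP-++ ρ varX varY ⟩
                    evalP ρ varX + evalP ρ varY
                      ≡⟨ cong₂ _+_ (evalP-varX 0ℚ D M S K) (evalP-varY 0ℚ D M S K) ⟩
                    S + K
                      ≡⟨ trans (ℚP.+-comm S K) (sym (fromℕ-+ k s)) ⟩
                    fromℕ (k ℕ.+ s) ∎)))
                 (trans (evalP-pow ρ varY β) (cong (_^ β) (evalP-varY 0ℚ D M S K))))
      where
      D = fromℕ d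
      M = fromℕ m
      S = fromℕ s
      K = fromℕ k
      ρ = at0 d m s k

    prepended-eval : ∀ d m h s k → evalP (env (fromℕ h) (fromℕ d) (fromℕ m) (fromℕ s) (fromℕ k)) prepended
                                   ≡ power α β (towerWeight m h ℕ.+ (k ℕ.+ (k ℕ.+ s))) (h ℕ.+ k)
    prepended-eval d m h s k = trans (evalP-mul ρ (powP (varX ++ newColumn) α) (powP (varY ++ varH) β))
      (cong₂ _*_ (trans (evalP-pow ρ (varX ++ newColumn) α) (cong (_^ α) σ-part))
                 (trans (evalP-pow ρ (varY ++ varH) β) (cong (_^ β) size-part)))
      where
      H = fromℕ h
      D = fromℕ d
      M = fromℕ m
      S = fromℕ s
      K = fromℕ k
      ρ = env H D M S K
      T = fromℕ (towerWeight m h)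
      σ-part : evalP ρ (varX ++ newColumn) ≡ fromℕ (towerWeight m h ℕ.+ (k ℕ.+ (k ℕ.+ s)))
      σ-part = begin
        evalP ρ (varX ++ newColumn)
          ≡⟨ evalP-++ ρ varX newColumn ⟩
        evalP ρ varX + evalP ρ newColumn
          ≡⟨ cong₂ _+_ (evalP-varX H D M S K)
               (trans (evalP-++ ρ towerPoly (scaleP (1ℚ + 1ℚ) varY))
                 (cong₂ _+_ (trans (towerPoly-eval H D M S K) (sym (towerWeight-eval m h)))
                            (trans (evalP-scale ρ (1ℚ + 1ℚ) varY) (cong ((1ℚ + 1ℚ) *_) (evalP-varY H D M S K))))) ⟩
        S + (T + (1ℚ + 1ℚ) * K)
          ≡⟨ solve 3 (λ S T K → S :+ (T :+ (con 1ℚ :+ con 1ℚ) :* K) := T :+ (K :+ (K :+ S))) refl S T K ⟩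
        T + (K + (K + S))
          ≡⟨ sym (trans (fromℕ-+ (towerWeight m h) (k ℕ.+ (k ℕ.+ s)))
                   (cong (T +_) (trans (fromℕ-+ k (k ℕ.+ s)) (cong (K +_) (fromℕ-+ k s))))) ⟩
        fromℕ (towerWeight m h ℕ.+ (k ℕ.+ (k ℕ.+ s))) ∎
      size-part : evalP ρ (varY ++ varH) ≡ fromℕ (h ℕ.+ k)
      size-part = trans (evalP-++ ρ varY varH)
        (trans (cong₂ _+_ (evalP-varY H D M S K) (evalP-varH H D M S K)) (trans (ℚP.+-comm K H) (sym (fromℕ-+ h k))))

module MomentRecurrence where

  open Rational using (_+_; _*_; -_)
  open NatCast
  open PowerSeries
  open PartialFractions
  open Polynomials
  open PowerSums
  open NiceSubsets
  open Moments
  open ColumnExpansions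

  qTimesAt0 : Poly → Poly3
  qTimesAt0 []                      = []
  qTimesAt0 (mono c a b e f g ∷ p) = (c * (0ℚ ^ a * (0ℚ ^ f * 0ℚ ^ g)) , b , e , 1) ∷ qTimesAt0 p

  qTimesAt0-0 : ∀ p d m → polySeries (qTimesAt0 p) d m 0 ≡ 0ℚ
  qTimesAt0-0 []                      d m = refl
  qTimesAt0-0 (mono c a b e f g ∷ p) d m = trans (ℚP.+-identityˡ _) (qTimesAt0-0 p d m)

  qTimesAt0-1 : ∀ p d m → polySeries (qTimesAt0 p) d m 1 ≡ evalP (env 0ℚ (fromℕ d) (fromℕ m) 0ℚ 0ℚ) p
  qTimesAt0-1 []                      d m = refl
  qTimesAt0-1 (mono c a b e f g ∷ p) d m =
    cong₂ _+_ (trans (cong (c * (0ℚ ^ a * (0ℚ ^ f * 0ℚ ^ g)) *_)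
                           (trans (fromℕ-* (d ℕ.^ b) (m ℕ.^ e)) (cong₂ _*_ (fromℕ-^ d b) (fromℕ-^ m e))))
                     (solve 6 (λ c z D M x y → c :* (z :* (x :* y)) :* (D :* M) := c :* (z :* (D :* (M :* (x :* y))))) refl
                        c (0ℚ ^ a) (fromℕ d ^ b) (fromℕ m ^ e) (0ℚ ^ f) (0ℚ ^ g)))
              (qTimesAt0-1 p d m)

  qTimesAt0-suc-suc : ∀ p d m n → polySeries (qTimesAt0 p) d m (suc (suc n)) ≡ 0ℚ
  qTimesAt0-suc-suc []                      d m n = refl
  qTimesAt0-suc-suc (mono c a b e f g ∷ p) d m n = trans (ℚP.+-identityˡ _) (qTimesAt0-suc-suc p d m n)

  qTimesAt0-degm : ∀ v p → Wt.AllW (ℕ._< suc v) p → degm≤ (qTimesAt0 p) v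
  qTimesAt0-degm v []                      _        = tt
  qTimesAt0-degm v (mono c a b e f g ∷ p) (lt , r) =
    ℕP.≤-trans (ℕP.m≤m+n e (f ℕ.+ (f ℕ.+ g))) (ℕP.≤-pred lt) , qTimesAt0-degm v p r

  cancel : ∀ x r → x ≡ x + r → r ≡ 0ℚ
  cancel x r e = trans (solve 2 (λ x r → r := (x :+ r) :+ :- x) refl x r)
                       (trans (cong (_+ - x) (sym e)) (ℚP.+-inverseʳ x))

  module Recurrence (α β : ℕ) (lower : LowerMoments (momentWeight α β)) where
    open Expansions α β

    R₁ = proj₁ shifted-leading
    Q₂ = sumOverH (proj₁ prepended-leading)
    Qₜ = sumOverH prepended

    at : ℕ → ℕ → ℕ → ℕ → ℕ → Env
    at d m h s k = env (fromℕ h) (fromℕ d) (fromℕ m) (fromℕ s) (fromℕ k)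

    t : ℕ → ℕ → Series
    t d m zero          = power α β 0 0
    t d m (suc zero)    = Σ₁ d (λ h → evalP (at d m h 0 0) prepended)
    t d m (suc (suc n)) = polyMoment R₁ d m (suc n) + polyMoment (proj₁ Q₂) d m n

    shifted-moment : ∀ d m n → niceSum d m n (λ s k → power α β (k ℕ.+ s) k) ≡ moment α β d m n + polyMoment R₁ d m n
    shifted-moment d m n =
      trans (niceSum-cong d m n (λ s k → trans (sym (shifted-eval d m s k))
              (trans (proj₂ (proj₂ shifted-leading) (at0 d m s k)) (cong (_+ evalP (at0 d m s k) R₁) (leading-eval 0ℚ d m s k)))))
            (niceSum-+ d m n (power α β) (λ s k → evalP (at0 d m s k) R₁))

    prepended-moments : ∀ d m n →
      Σ₁ d (λ h → niceSum d m n (λ s k → power α β (towerWeight m h ℕ.+ (k ℕ.+ (k ℕ.+ s))) (h ℕ.+ k)))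
        ≡ fromℕ d * moment α β d m n + polyMoment (proj₁ Q₂) d m n
    prepended-moments d m n = begin
      Σ₁ d (λ h → niceSum d m n (λ s k → power α β (towerWeight m h ℕ.+ (k ℕ.+ (k ℕ.+ s))) (h ℕ.+ k)))
        ≡⟨ sym (niceSum-Σ₁ d m n d (λ s k h → power α β (towerWeight m h ℕ.+ (k ℕ.+ (k ℕ.+ s))) (h ℕ.+ k))) ⟩
      niceSum d m n (λ s k → Σ₁ d (λ h → power α β (towerWeight m h ℕ.+ (k ℕ.+ (k ℕ.+ s))) (h ℕ.+ k)))
        ≡⟨ niceSum-cong d m n pointwise ⟩
      niceSum d m n (λ s k → fromℕ d * power α β s k + evalP (at0 d m s k) (proj₁ Q₂))
        ≡⟨ niceSum-+ d m n (λ s k → fromℕ d * power α β s k) (λ s k → evalP (at0 d m s k) (proj₁ Q₂)) ⟩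
      niceSum d m n (λ s k → fromℕ d * power α β s k) + polyMoment (proj₁ Q₂) d m n
        ≡⟨ cong (_+ polyMoment (proj₁ Q₂) d m n) (niceSum-* d m n (fromℕ d) (power α β)) ⟩
      fromℕ d * moment α β d m n + polyMoment (proj₁ Q₂) d m n ∎
      where
      R₂ = proj₁ prepended-leading
      pointwise : ∀ s k → Σ₁ d (λ h → power α β (towerWeight m h ℕ.+ (k ℕ.+ (k ℕ.+ s))) (h ℕ.+ k))
                          ≡ fromℕ d * power α β s k + evalP (at0 d m s k) (proj₁ Q₂)
      pointwise s k = begin
        Σ₁ d (λ h → power α β (towerWeight m h ℕ.+ (k ℕ.+ (k ℕ.+ s))) (h ℕ.+ k))
          ≡⟨ Σ₁-cong d (λ h → trans (sym (prepended-eval d m h s k))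
               (trans (proj₂ (proj₂ prepended-leading) (at d m h s k)) (cong (_+ evalP (at d m h s k) R₂) (leading-eval (fromℕ h) d m s k)))) ⟩
        Σ₁ d (λ h → power α β s k + evalP (at d m h s k) R₂)
          ≡⟨ Σ₁-+ d (λ _ → power α β s k) (λ h → evalP (at d m h s k) R₂) ⟩
        Σ₁ d (λ _ → power α β s k) + Σ₁ d (λ h → evalP (at d m h s k) R₂)
          ≡⟨ cong₂ _+_ (Σ₁-const d (power α β s k)) (sym (proj₂ (proj₂ Q₂) 0ℚ d (fromℕ m) (fromℕ s) (fromℕ k))) ⟩
        fromℕ d * power α β s k + evalP (at0 d m s k) (proj₁ Q₂) ∎

    moment-1 : ∀ d m → moment α β d m 1 ≡ power α β 0 0 + t d m 1
    moment-1 d m = trans (niceSum-suc d m 0 (power α β))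
      (cong₂ _+_ (niceSum-0 d m (λ s k → power α β (k ℕ.+ s) k))
                 (Σ₁-cong d (λ h → trans (niceSum°-0 d m (λ s k → power α β (towerWeight m h ℕ.+ (k ℕ.+ s)) (h ℕ.+ k)))
                                         (sym (prepended-eval d m h 0 0)))))

    moment-recurrence : ∀ d m n → moment α β d m (suc (suc n)) ≡ t d m (suc (suc n)) + moment α β d m (suc n) + fromℕ d * moment α β d m n
    moment-recurrence d m n = begin
      moment α β d m (suc (suc n))
        ≡⟨ niceSum-suc d m (suc n) (power α β) ⟩
      niceSum d m (suc n) (λ s k → power α β (k ℕ.+ s) k)
        + Σ₁ d (λ h → niceSum° d m (suc n) (λ s k → power α β (towerWeight m h ℕ.+ (k ℕ.+ s)) (h ℕ.+ k)))
        ≡⟨ cong₂ _+_ (shifted-moment d m (suc n))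
             (trans (Σ₁-cong d (λ h → niceSum°-suc d m n (λ s k → power α β (towerWeight m h ℕ.+ (k ℕ.+ s)) (h ℕ.+ k))))
                    (prepended-moments d m n)) ⟩
      (M₁ + polyMoment R₁ d m (suc n)) + (fromℕ d * M₀ + polyMoment (proj₁ Q₂) d m n)
        ≡⟨ solve 5 (λ a b D c e → (a :+ b) :+ (D :* c :+ e) := (b :+ e) :+ a :+ D :* c) refl
             M₁ (polyMoment R₁ d m (suc n)) (fromℕ d) M₀ (polyMoment (proj₁ Q₂) d m n) ⟩
      t d m (suc (suc n)) + M₁ + fromℕ d * M₀ ∎
      where
      M₀ = moment α β d m n
      M₁ = moment α β d m (suc n)

    moment≐invD·t : ∀ d m → moment α β d m ≐ conv (invD d) (t d m)
    moment≐invD·t d m = recurrence-unique (fromℕ d) (moment α β d m) (conv (invD d) (t d m)) (λ n → t d m (suc (suc n)))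
      (trans (niceSum-0 d m (power α β)) (sym (ℚP.*-identityˡ (t d m 0))))
      (trans (moment-1 d m) (solve 2 (λ a b → a :+ b := con 1ℚ :* b :+ con 1ℚ :* a) refl (power α β 0 0) (t d m 1)))
      (moment-recurrence d m)
      (invD-conv-recurrence d (t d m))

    B : Poly3
    B = (power α β 0 0 , 0 , 0 , 0) ∷ qTimesAt0 (proj₁ Qₜ)

    B-degm : degm≤ B W
    B-degm = z≤n , qTimesAt0-degm W (proj₁ Qₜ) (proj₁ (proj₂ Qₜ) (suc W) prepended-weight)

    R₁-at-0 : ∀ d m → polyMoment R₁ d m 0 ≡ 0ℚ
    R₁-at-0 d m = trans (niceSum-0 d m (λ s k → evalP (at0 d m s k) R₁))
      (cancel (power α β 0 0) (evalP (at0 d m 0 0) R₁)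
        (trans (sym (shifted-eval d m 0 0))
          (trans (proj₂ (proj₂ shifted-leading) (at0 d m 0 0)) (cong (_+ evalP (at0 d m 0 0) R₁) (leading-eval 0ℚ d m 0 0)))))

    t-decomposition : ∀ d m → (polySeries B d m ⊕ shiftS (polyMoment R₁ d m)) ⊕ shiftS (shiftS (polyMoment (proj₁ Q₂) d m)) ≐ t d m
    t-decomposition d m zero = begin
      polySeries B d m 0 + 0ℚ + 0ℚ
        ≡⟨ trans (ℚP.+-identityʳ (polySeries B d m 0 + 0ℚ)) (ℚP.+-identityʳ (polySeries B d m 0)) ⟩
      power α β 0 0 * fromℕ 1 + polySeries (qTimesAt0 (proj₁ Qₜ)) d m 0
        ≡⟨ cong (power α β 0 0 * fromℕ 1 +_) (qTimesAt0-0 (proj₁ Qₜ) d m) ⟩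
      power α β 0 0 * 1ℚ + 0ℚ
        ≡⟨ trans (ℚP.+-identityʳ (power α β 0 0 * 1ℚ)) (ℚP.*-identityʳ (power α β 0 0)) ⟩
      power α β 0 0 ∎
    t-decomposition d m (suc zero) = begin
      polySeries B d m 1 + polyMoment R₁ d m 0 + 0ℚ
        ≡⟨ ℚP.+-identityʳ (polySeries B d m 1 + polyMoment R₁ d m 0) ⟩
      (0ℚ + polySeries (qTimesAt0 (proj₁ Qₜ)) d m 1) + polyMoment R₁ d m 0
        ≡⟨ cong₂ _+_ (trans (ℚP.+-identityˡ _) (qTimesAt0-1 (proj₁ Qₜ) d m)) (R₁-at-0 d m) ⟩
      evalP (env 0ℚ (fromℕ d) (fromℕ m) 0ℚ 0ℚ) (proj₁ Qₜ) + 0ℚ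
        ≡⟨ trans (ℚP.+-identityʳ _) (proj₂ (proj₂ Qₜ) 0ℚ d (fromℕ m) 0ℚ 0ℚ) ⟩
      t d m 1 ∎
    t-decomposition d m (suc (suc n)) = begin
      polySeries B d m (suc (suc n)) + polyMoment R₁ d m (suc n) + polyMoment (proj₁ Q₂) d m n
        ≡⟨ cong (λ z → z + polyMoment R₁ d m (suc n) + polyMoment (proj₁ Q₂) d m n)
             (trans (ℚP.+-identityˡ _) (qTimesAt0-suc-suc (proj₁ Qₜ) d m n)) ⟩
      0ℚ + polyMoment R₁ d m (suc n) + polyMoment (proj₁ Q₂) d m n
        ≡⟨ cong (_+ polyMoment (proj₁ Q₂) d m n) (ℚP.+-identityˡ (polyMoment R₁ d m (suc n))) ⟩
      t d m (suc (suc n)) ∎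

    t-PF : PartialFractions W t
    t-PF = PF-resp t-decomposition
      (PF-add (PF-add (PF-poly W B B-degm) (PF-shift (polyMoment-PF W lower R₁ (proj₁ (proj₂ shifted-leading)))))
              (PF-shift (PF-shift (polyMoment-PF W lower (proj₁ Q₂)
                                     (proj₁ (proj₂ Q₂) W (proj₁ (proj₂ prepended-leading)))))))

    moment-OverD : OverD W (moment α β)
    moment-OverD = proj₁ t-PF , proj₁ (proj₂ t-PF) ,
      λ d m n → trans (moment≐invD·t d m n) (conv-congʳ (invD d) (proj₂ (proj₂ t-PF) d m) n)

  moment-OverD-bounded : ∀ B α β → momentWeight α β ℕ.≤ B → OverD (momentWeight α β) (moment α β)
  moment-OverD-bounded zero    α β le = Recurrence.moment-OverD α β
    (λ α' β' lt → ⊥-elim (ℕP.<⇒≱ (ℕP.<-≤-trans lt le) z≤n))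
  moment-OverD-bounded (suc B) α β le = Recurrence.moment-OverD α β
    (λ α' β' lt → OverD⇒PF (moment-OverD-bounded B α' β' (ℕP.≤-pred (ℕP.≤-trans lt le))))

  moment-OverD : ∀ α β → OverD (momentWeight α β) (moment α β)
  moment-OverD α β = moment-OverD-bounded (momentWeight α β) α β ℕP.≤-refl

open import Data.Nat using (_+_; _*_; _∸_; _≤_)

-- 2a + b + 1 numerators, the j-th one (j = 0, …, 2a+b) of m-degree ≤ 2a+b-j.
theorem4p1 : (a b : ℕ) →
    Σ (Fin (2 * a + b + 1) → Poly3) (λ P →
    ((k : Fin (2 * a + b + 1)) → degm≤ (P k) ((2 * a + b + 1) ∸ (toℕ k + 1))) ×
    ((d : ℕ) → 1 ≤ d → (m : ℕ) → (n : ℕ) →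
    fromℕ (Gplus d m a b n)
    ≡ sumS (λ k → polySeries (P k) d m ⊛ (invD d ^S (toℕ k + 1))) n))
theorem4p1 a b = (λ k → nth Ns (toℕ k)) , degrees , expansion
  where
  open PowerSeries using (conv)
  open PartialFractions
  open NiceSubsets using (Gplus≡niceSum)
  open Moments using (momentWeight)
  open MomentRecurrence using (moment-OverD)

  W = momentWeight a b
  Ns = proj₁ (moment-OverD a b)
  rank = proj₁ (proj₂ (moment-OverD a b))

  terms : 2 * a + b + 1 ≡ suc W
  terms = count a b
    where
    count : ∀ a b → 2 * a + b + 1 ≡ suc (a + (a + b))
    count = solve-∀

  degrees : (k : Fin (2 * a + b + 1)) → degm≤ (nth Ns (toℕ k)) ((2 * a + b + 1) ∸ (toℕ k + 1))
  degrees k = subst (degm≤ (nth Ns (toℕ k))) (sym (cong₂ _∸_ terms (ℕP.+-comm (toℕ k) 1))) (HasRank-nth W Ns rank (toℕ k))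

  expansion : (d : ℕ) → 1 ≤ d → (m : ℕ) → (n : ℕ) →
    fromℕ (Gplus d m a b n) ≡ sumS {2 * a + b + 1} (λ k → fraction d m Ns (toℕ k)) n
  expansion d _ m n = begin
    fromℕ (Gplus d m a b n)
      ≡⟨ Gplus≡niceSum d m a b n ⟩
    Moments.moment a b d m n
      ≡⟨ proj₂ (proj₂ (moment-OverD a b)) d m n ⟩
    conv (invD d) (hornerSeries Ns d m) n
      ≡⟨ invD-horner (2 * a + b + 1) Ns (subst (length Ns ℕ.≤_) (sym terms) (HasRank-length W Ns rank)) d m n ⟩
    sumS {2 * a + b + 1} (λ k → fraction d m Ns (toℕ k)) n ∎
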